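{- For every positive integer $n$, $$C_n(x)=\sum_{T\in\operatorname{SYT}(n)}\left(\prod_{i=1}^n\sigma_i(T)\,(i!)^{w_i(T)}\right)x^{n+1-\ell(\lambda(T))}.$$
   Context: $\mathcal{Q}_n$ is the set of Stirling permutations of $\{1,1,\ldots,n,n\}$ (words using each of $1,\ldots,n$ twice such that all letters between the two occurrences of $i$ are $\geqslant i$); with $\sigma_0=\sigma_{2n+1}=0$, ${\rm des}(\sigma)=\#\{i\in\{0,\ldots,2n\}:\sigma_i>\sigma_{i+1}\}$ and $C_n(x)=\sum_{\sigma\in\mathcal{Q}_n}x^{{\rm des}(\sigma)}$. $\operatorname{SYT}(n)$ is the set of standard Young tableaux with $n$ boxes (French convention). $\ell(\lambda(T))$ is the number of rows of $T$ and $w_i(T)$ the number of rows with exactly $i$ boxes. For $1\leqslant i\leqslant n$, $T_i$ is obtained from $T$ by deleting entries $i+1,\ldots,n$, and $\operatorname{col}_k(T_i)$ is the size of its $k$-th column; $\sigma_i(T)=i-\operatorname{col}_1(T_i)+1$ if $i$ lies in the first column of $T$, and $\sigma_i(T)=\operatorname{col}_k(T_i)-\operatorname{col}_{k+1}(T_i)+1$ if $i$ lies in the $(k+1)$-th column, $k\geqslant1$. -}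

module Defs where

open import Data.Nat using (ℕ; zero; suc; _+_; _*_; _∸_; _^_; _≤_; _<_; _≡ᵇ_; _<ᵇ_; _≤?_; _!)

open import Data.Bool using (Bool; true; false; if_then_else_)
open import Data.List using (List; []; _∷_; _++_; [_]; length; map; filter; upTo; concat; lookup)
open import Data.List.Relation.Unary.All using (All)
open import Data.List.Relation.Unary.Linked using (Linked)
open import Data.List.Relation.Binary.Permutation.Propositional using (_↭_)
open import Data.Nat.ListAction using (sum; product)
open import Data.Maybe using (Maybe; just; nothing)
open import Data.Fin as Fin using (Fin)
open import Data.Unit using (⊤)
open import Data.Empty using (⊥)
open import Data.Product using (_×_)
open import Relation.Binary.PropositionalEquality using (_≡_; _≢_)
open import Relation.Nullary.Decidable using (⌊_⌋)

Word : Set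
Word = List ℕ

oneTo : ℕ → List ℕ
oneTo n = map suc (upTo n)

record Stirling (n : ℕ) (w : Word) : Set where
  field
    len     : length w ≡ 2 * n
    letters : All (λ a → 1 ≤ a × a ≤ n) w
    twice   : All (λ i → length (filter (λ a → a Data.Nat.≟ i) w) ≡ 2) (oneTo n)
    nested  : (p q r : Fin (length w)) → p Fin.< q → q Fin.< r →
              lookup w p ≡ lookup w r → lookup w p ≤ lookup w q

descents : List ℕ → ℕ
descents []           = 0
descents (a ∷ [])     = 0
descents (a ∷ b ∷ xs) = (if b <ᵇ a then 1 else 0) + descents (b ∷ xs)

-- des σ with σ_0 = σ_{2n+1} = 0
des : Word → ℕ
des w = descents (0 ∷ w ++ [ 0 ])

-- coefficient of x^k in Σ_{σ ∈ L} x^{des σ}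
CCoeff : List Word → ℕ → ℕ
CCoeff L k = sum (map (λ w → if des w ≡ᵇ k then 1 else 0) L)

-- A tableau is a list of rows, bottom row first; each row read left to right.
Tableau : Set
Tableau = List (List ℕ)

ColOK : List ℕ → List ℕ → Set
ColOK lo       []       = ⊤
ColOK []       (b ∷ bs) = ⊥
ColOK (a ∷ as) (b ∷ bs) = a < b × ColOK as bs

record IsSYT (n : ℕ) (T : Tableau) : Set where
  field
    nonempty : All (λ r → r ≢ []) T
    rowsInc  : All (Linked _<_) T
    colsInc  : Linked ColOK T
    entries  : concat T ↭ oneTo n

-- T_i : delete entries i+1..n (empty rows are harmless for column sizes)
restrict : ℕ → Tableau → Tableau
restrict i T = map (filter (λ a → a ≤? i)) T

colSize : ℕ → Tableau → ℕ
colSize k T = length (filter (λ r → k ≤? length r) T)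

-- 1-based position of i in a row
posIn : ℕ → List ℕ → Maybe ℕ
posIn i []       = nothing
posIn i (x ∷ xs) with x ≡ᵇ i
... | true  = just 1
... | false = Data.Maybe.map suc (posIn i xs)

-- 1-based column of i in T (0 if absent)
colOf : ℕ → Tableau → ℕ
colOf i []       = 0
colOf i (r ∷ rs) with posIn i r
... | just c  = c
... | nothing = colOf i rs

sigma : ℕ → Tableau → ℕ
sigma i T with colOf i T
... | 0             = 0
... | 1             = i ∸ colSize 1 (restrict i T) + 1
... | suc (suc k)   = colSize (suc k) (restrict i T) ∸ colSize (suc (suc k)) (restrict i T) + 1

rowsOfLength : ℕ → Tableau → ℕ
rowsOfLength i T = length (filter (λ r → length r Data.Nat.≟ i) T)

numRows : Tableau → ℕ
numRows T = length T

weight : ℕ → Tableau → ℕ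
weight n T = product (map (λ i → sigma i T * (i !) ^ rowsOfLength i T) (oneTo n))

-- coefficient of x^k in Σ_{T ∈ L} weight(T) x^{n+1-ℓ(λ(T))}
RCoeff : ℕ → List Tableau → ℕ → ℕ
RCoeff n L k = sum (map (λ T → if (n + 1 ∸ numRows T) ≡ᵇ k then weight n T else 0) L)

-- Both sides satisfy c_{n+1}(k) = k c_n(k) + (2n + 2 − k) c_n(k − 1) and agree at n = 1.
--
-- Every σ ∈ Q_{n+1} arises from exactly one τ ∈ Q_n by inserting the factor (n+1)(n+1) into
-- one of the 2n + 1 gaps of τ (a letter between the two copies of n + 1 would have to be at
-- least n + 1).  This keeps the number of descents when the gap follows a descent of τ and
-- adds one otherwise.
--
-- Every T′ ∈ SYT(n+1) arises from exactly one T ∈ SYT(n) by putting n + 1 into a new top row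
-- or at the end of a row shorter than the row below it.  A new top row keeps the exponent
-- and multiplies the weight by σ_{n+1} = n + 1 − ℓ(T).  Appending n + 1 to the highest row
-- of length L raises the exponent by one and multiplies the weight by (L + 1) w_L(T); summed
-- over the possible L these factors give Σ_r (|r| + 1) = n + ℓ(T) = (2n + 1) − (n + 1 − ℓ(T)).

module Submission where

open import Defs
import Data.Bool as Bool
open import Data.Bool using (true; false; if_then_else_)
open import Data.Empty using (⊥; ⊥-elim)
open import Data.Fin as Fin using (Fin; toℕ)
open import Data.List using (List; []; _∷_; _++_; [_]; _∷ʳ_; map; length; filter; concat; concatMap; upTo; lookup)
open import Data.List.Properties
  using (++-assoc; ++-identityʳ; ∷-injective; length-++; length-map; length-upTo; upTo-∷ʳ; map-++; map-∘; map-cong;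
         filter-++; filter-accept; filter-reject; filter-all; filter-none)
open import Data.List.Membership.Propositional using (_∈_; find; lose)
open import Data.List.Membership.Propositional.Properties
  using (∈-concatMap⁺; ∈-concatMap⁻; ∈-concat⁺′; ∈-∃++; ∈-++⁺ʳ; ∈-++⁻; ∈-map⁺; ∈-map⁻; ∈-upTo⁺; ∈-upTo⁻)
open import Data.List.Membership.Propositional.Properties.WithK using (unique∧set⇒bag)
open import Data.List.Relation.Binary.BagAndSetEquality using (∼bag⇒↭)
open import Data.List.Relation.Binary.Permutation.Propositional using (_↭_; ↭-refl; ↭-trans; ↭-sym; ↭-reflexive; prep)
import Data.List.Relation.Binary.Permutation.Propositional.Properties as Perm
open import Data.List.Relation.Unary.All as All using (All; []; _∷_)
open import Data.List.Relation.Unary.All.Properties using (++⁺; ++⁻ˡ; ++⁻ʳ)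
open import Data.List.Relation.Unary.AllPairs using ([]; _∷_)
open import Data.List.Relation.Unary.Any using (here; there)
open import Data.List.Relation.Unary.Linked as Linked using (Linked; []; [-]; _∷_)
open import Data.List.Relation.Unary.Linked.Properties using (Linked⇒All)
open import Data.List.Relation.Unary.Unique.Propositional using (Unique)
import Data.List.Relation.Unary.Unique.Propositional.Properties as Unique
open import Data.Maybe as Maybe using (just; nothing)
open import Data.Nat
open import Data.Nat.ListAction using (sum; product)
open import Data.Nat.ListAction.Properties using (sum-↭; sum-++; product-++)
open import Data.Nat.Properties
open import Algebra.Properties.CommutativeSemigroup +-commutativeSemigroup using (x∙yz≈y∙xz)
open import Data.List.Membership.DecPropositional _≟_ using (_∈?_)
open import Data.Nat.Solver using (module +-*-Solver)
open import Data.Product using (∃; ∃₂; Σ; _×_; _,_; proj₁; proj₂)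
open import Data.Sum using (_⊎_; inj₁; inj₂)
open import Data.Unit using (⊤; tt)
open import Function.Base using (_∘_)
open import Function.Bundles using (_⇔_; mk⇔; Equivalence)
open import Function.Construct.Composition using (_⇔-∘_)
open import Function.Construct.Symmetry using (⇔-sym)
open import Relation.Binary.Definitions using (tri<; tri≈; tri>)
open import Relation.Binary.PropositionalEquality hiding ([_])
open import Relation.Nullary using (Dec; yes; no; ¬?)
open +-*-Solver using (solve; _:+_; _:*_; _:=_; con)

private
  variable
    X Y : Set

≡ᵇ-refl : ∀ m → (m ≡ᵇ m) ≡ true
≡ᵇ-refl zero    = refl
≡ᵇ-refl (suc m) = ≡ᵇ-refl m

≢⇒≡ᵇ-false : ∀ {m n} → m ≢ n → (m ≡ᵇ n) ≡ false
≢⇒≡ᵇ-false {m} {n} m≢n with m ≡ᵇ n in eq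
... | true  = ⊥-elim (m≢n (≡ᵇ⇒≡ m n (subst Bool.T (sym eq) _)))
... | false = refl

if-≡ᵇ-refl : ∀ m {x y : X} → (if m ≡ᵇ m then x else y) ≡ x
if-≡ᵇ-refl m rewrite ≡ᵇ-refl m = refl

if-≡ᵇ-≢ : ∀ {m n} {x y : X} → m ≢ n → (if m ≡ᵇ n then x else y) ≡ y
if-≡ᵇ-≢ m≢n rewrite ≢⇒≡ᵇ-false m≢n = refl

<⇒<ᵇ-true : ∀ {m n} → m < n → (m <ᵇ n) ≡ true
<⇒<ᵇ-true {zero}  {suc n} _         = refl
<⇒<ᵇ-true {suc m} {suc n} (s≤s m<n) = <⇒<ᵇ-true m<n

<ᵇ-true⇒< : ∀ {m n} → (m <ᵇ n) ≡ true → m < n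
<ᵇ-true⇒< {m} {n} m<ᵇn = <ᵇ⇒< m n (subst Bool.T (sym m<ᵇn) _)

≥⇒<ᵇ-false : ∀ {m n} → n ≤ m → (m <ᵇ n) ≡ false
≥⇒<ᵇ-false {m}     {zero}  _         = refl
≥⇒<ᵇ-false {suc m} {suc n} (s≤s n≤m) = ≥⇒<ᵇ-false n≤m

if-then-else-0 : ∀ b w → (if b then w else 0) ≡ w * (if b then 1 else 0)
if-then-else-0 true  w = sym (*-identityʳ w)
if-then-else-0 false w = sym (*-zeroʳ w)

sum-map-sameMembers : (f : X → ℕ) {xs ys : List X} → Unique xs → Unique ys →
  (∀ x → (x ∈ xs) ⇔ (x ∈ ys)) → sum (map f xs) ≡ sum (map f ys)
sum-map-sameMembers f xs! ys! xs≈ys =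
  sum-↭ (Perm.map⁺ f (∼bag⇒↭ (unique∧set⇒bag xs! ys! (λ {x} → xs≈ys x))))

sum-map-concatMap : (f : Y → ℕ) (g : X → List Y) (xs : List X) →
  sum (map f (concatMap g xs)) ≡ sum (map (λ x → sum (map f (g x))) xs)
sum-map-concatMap f g []       = refl
sum-map-concatMap f g (x ∷ xs) = begin
  sum (map f (g x ++ concatMap g xs))               ≡⟨ cong sum (map-++ f (g x) _) ⟩
  sum (map f (g x) ++ map f (concatMap g xs))       ≡⟨ sum-++ (map f (g x)) _ ⟩
  sum (map f (g x)) + sum (map f (concatMap g xs))  ≡⟨ cong (sum (map f (g x)) +_) (sum-map-concatMap f g xs) ⟩
  sum (map f (g x)) + sum (map (λ x → sum (map f (g x))) xs) ∎
  where open ≡-Reasoning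

sum-map-congᴬ : {P : X → Set} (f g : X → ℕ) {xs : List X} → All P xs →
  (∀ {x} → P x → f x ≡ g x) → sum (map f xs) ≡ sum (map g xs)
sum-map-congᴬ f g []         f≗g = refl
sum-map-congᴬ f g (px ∷ pxs) f≗g = cong₂ _+_ (f≗g px) (sum-map-congᴬ f g pxs f≗g)

∈-concatMap⁻′ : (g : X → List Y) {xs : List X} {y : Y} →
  y ∈ concatMap g xs → ∃ λ x → x ∈ xs × y ∈ g x
∈-concatMap⁻′ g y∈ = find (∈-concatMap⁻ g y∈)

∈-concatMap⁺′ : (g : X → List Y) {xs : List X} {x : X} {y : Y} →
  x ∈ xs → y ∈ g x → y ∈ concatMap g xs
∈-concatMap⁺′ g x∈ y∈ = ∈-concatMap⁺ g (lose x∈ y∈)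

concatMap-unique : {P : X → Set} (g : X → List Y) {xs : List X} → Unique xs → All P xs →
  (∀ {x} → P x → Unique (g x)) →
  (∀ {x x' y} → P x → P x' → y ∈ g x → y ∈ g x' → x ≡ x') →
  Unique (concatMap g xs)
concatMap-unique g []             []         g! g-disj = []
concatMap-unique g {x ∷ xs} (x∉xs ∷ xs!) (px ∷ pxs) g! g-disj =
  Unique.++⁺ (g! px) (concatMap-unique g xs! pxs g! g-disj) disjoint
  where
  disjoint : ∀ {y} → y ∈ g x × y ∈ concatMap g xs → ⊥
  disjoint (y∈gx , y∈rest) with ∈-concatMap⁻′ g y∈rest
  ... | x' , x'∈xs , y∈gx' =
    All.lookup x∉xs x'∈xs (g-disj px (All.lookup pxs x'∈xs) y∈gx y∈gx')

∈-oneTo⁺ : ∀ {n i} → 1 ≤ i → i ≤ n → i ∈ oneTo n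
∈-oneTo⁺ {i = suc j} (s≤s z≤n) j<n = ∈-map⁺ suc (∈-upTo⁺ j<n)

∈-oneTo⁻ : ∀ {n i} → i ∈ oneTo n → 1 ≤ i × i ≤ n
∈-oneTo⁻ i∈ with ∈-map⁻ suc i∈
... | j , j∈ , refl = s≤s z≤n , ∈-upTo⁻ j∈

oneTo-suc : ∀ n → oneTo (suc n) ≡ oneTo n ∷ʳ suc n
oneTo-suc n = trans (cong (map suc) (sym (upTo-∷ʳ n))) (map-++ suc (upTo n) [ n ])

length-oneTo : ∀ n → length (oneTo n) ≡ n
length-oneTo n = trans (length-map suc (upTo n)) (length-upTo n)

All-delete : {P : X → Set} (u : List X) {e : X} {v : List X} → All P (u ++ e ∷ v) → All P (u ++ v)
All-delete u Puev = ++⁺ (++⁻ˡ u Puev) (All.tail (++⁻ʳ u Puev))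

All-insert : {P : X → Set} (u : List X) {e : X} {v : List X} → P e → All P (u ++ v) → All P (u ++ e ∷ v)
All-insert u Pe Puv = ++⁺ (++⁻ˡ u Puv) (Pe ∷ ++⁻ʳ u Puv)

++-split : (xs ys zs ws : List X) → xs ++ ys ≡ zs ++ ws →
  (∃ λ t → zs ≡ xs ++ t × ys ≡ t ++ ws) ⊎ (∃ λ t → xs ≡ zs ++ t × ws ≡ t ++ ys)
++-split []       ys zs       ws eq = inj₁ (zs , refl , eq)
++-split (x ∷ xs) ys []       ws eq = inj₂ (x ∷ xs , refl , sym eq)
++-split (x ∷ xs) ys (z ∷ zs) ws eq with ∷-injective eq
... | refl , eq′ with ++-split xs ys zs ws eq′
... | inj₁ (t , p , q) = inj₁ (t , cong (x ∷_) p , q)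
... | inj₂ (t , p , q) = inj₂ (t , cong (x ∷_) p , q)

length-snoc : ∀ (xs : List X) x → length (xs ++ [ x ]) ≡ suc (length xs)
length-snoc xs x = trans (length-++ xs) (+-comm (length xs) 1)

nonempty⇒1≤length : ∀ (xs : List X) → xs ≢ [] → 1 ≤ length xs
nonempty⇒1≤length []      xs≢[] = ⊥-elim (xs≢[] refl)
nonempty⇒1≤length (_ ∷ _) _    = s≤s z≤n

removeAll : ℕ → List ℕ → List ℕ
removeAll m = filter (λ a → ¬? (a ≟ m))

removeAll-∉ : ∀ {m} w → All (_≢ m) w → removeAll m w ≡ w
removeAll-∉ {m} w m∉w = filter-all (λ a → ¬? (a ≟ m)) m∉w

removeAll-snoc : ∀ {m} r → All (_≢ m) r → removeAll m (r ++ [ m ]) ≡ r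
removeAll-snoc {m} r m∉r = begin
  removeAll m (r ++ [ m ])          ≡⟨ filter-++ ≢m? r [ m ] ⟩
  removeAll m r ++ removeAll m [ m ] ≡⟨ cong₂ _++_ (removeAll-∉ r m∉r) (filter-reject ≢m? (λ m≢m → m≢m refl)) ⟩
  r ++ []                           ≡⟨ ++-identityʳ r ⟩
  r                                 ∎
  where
  open ≡-Reasoning
  ≢m? : (a : ℕ) → Dec (a ≢ m)
  ≢m? = λ a → ¬? (a ≟ m)

length-∈-≤-concat : ∀ {r : List ℕ} (T : Tableau) → r ∈ T → length r ≤ length (concat T)
length-∈-≤-concat (r ∷ T) (here refl) = ≤-trans (m≤m+n (length r) _) (≤-reflexive (sym (length-++ r)))
length-∈-≤-concat (s ∷ T) (there r∈T) =
  ≤-trans (length-∈-≤-concat T r∈T) (≤-trans (m≤n+m _ (length s)) (≤-reflexive (sym (length-++ s))))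

length≤length-concat : ∀ (T : Tableau) → All (_≢ []) T → length T ≤ length (concat T)
length≤length-concat []            _            = z≤n
length≤length-concat ([] ∷ T)      (r≢[] ∷ _)   = ⊥-elim (r≢[] refl)
length≤length-concat ((a ∷ r) ∷ T) (_ ∷ T≢[]) =
  s≤s (≤-trans (length≤length-concat T T≢[]) (≤-trans (m≤n+m _ (length r)) (≤-reflexive (sym (length-++ r)))))

-- The recurrence in coefficient form

ind : ℕ → ℕ → ℕ
ind k d = if d ≡ᵇ k then 1 else 0

-- The coefficient of x^k in Σ_{y ∈ ys} ω(y) x^{s(y)}; CCoeff and RCoeff are instances.
Coef : (X → ℕ) → (X → ℕ) → List X → ℕ → ℕ
Coef s ω ys k = sum (map (λ y → if s y ≡ᵇ k then ω y else 0) ys)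

-- step N c is the coefficient sequence of the image of Σ_j c_j x^j under the linear map
-- x^d ↦ d x^d + (N − d) x^(d+1), and spread N (ind k) d is the coefficient of x^k in the
-- image of x^d.  For N = 2n + 1 both sides of the theorem go from n to n + 1 by this map.
step : ℕ → (ℕ → ℕ) → ℕ → ℕ
step N c zero    = 0
step N c (suc j) = suc j * c (suc j) + (N ∸ j) * c j

spread : ℕ → (ℕ → ℕ) → ℕ → ℕ
spread N f d = d * f d + (N ∸ d) * f (suc d)

step-cong : ∀ N {c c' : ℕ → ℕ} → (∀ j → c j ≡ c' j) → ∀ k → step N c k ≡ step N c' k
step-cong N c≗c' zero    = refl
step-cong N c≗c' (suc j) = cong₂ (λ a b → suc j * a + (N ∸ j) * b) (c≗c' (suc j)) (c≗c' j)

step-+ : ∀ N (c c' : ℕ → ℕ) k → step N (λ j → c j + c' j) k ≡ step N c k + step N c' k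
step-+ N c c' zero    = refl
step-+ N c c' (suc j) =
  solve 6 (λ k a a' m b b' → k :* (a :+ a') :+ m :* (b :+ b') := (k :* a :+ m :* b) :+ (k :* a' :+ m :* b'))
    refl (suc j) (c (suc j)) (c' (suc j)) (N ∸ j) (c j) (c' j)

step-zero : ∀ N k → step N (λ _ → 0) k ≡ 0
step-zero N zero    = refl
step-zero N (suc j) rewrite *-zeroʳ j | *-zeroʳ (N ∸ j) = refl

*-ind : ∀ (f : ℕ → ℕ) d k → f d * ind k d ≡ f k * ind k d
*-ind f d k with d ≟ k
... | yes refl = refl
... | no  d≢k rewrite ≢⇒≡ᵇ-false d≢k = trans (*-zeroʳ (f d)) (sym (*-zeroʳ (f k)))

scaled-spread≡step : ∀ N ω d k → ω * spread N (ind k) d ≡ step N (λ j → if d ≡ᵇ j then ω else 0) k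
scaled-spread≡step N ω d zero = begin
  ω * (d * ind 0 d + (N ∸ d) * 0) ≡⟨ cong₂ (λ a b → ω * (a + b)) (*-ind (λ a → a) d 0) (*-zeroʳ (N ∸ d)) ⟩
  ω * 0                           ≡⟨ *-zeroʳ ω ⟩
  0                               ∎
  where open ≡-Reasoning
scaled-spread≡step N ω d (suc j) = begin
  ω * (d * ind (suc j) d + (N ∸ d) * ind j d)
    ≡⟨ cong₂ (λ a b → ω * (a + b)) (*-ind (λ a → a) d (suc j)) (*-ind (N ∸_) d j) ⟩
  ω * (suc j * ind (suc j) d + (N ∸ j) * ind j d)
    ≡⟨ solve 5 (λ ω k a m b → ω :* (k :* a :+ m :* b) := k :* (ω :* a) :+ m :* (ω :* b))
         refl ω (suc j) (ind (suc j) d) (N ∸ j) (ind j d) ⟩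
  suc j * (ω * ind (suc j) d) + (N ∸ j) * (ω * ind j d)
    ≡⟨ cong₂ (λ a b → suc j * a + (N ∸ j) * b) (if-then-else-0 (d ≡ᵇ suc j) ω) (if-then-else-0 (d ≡ᵇ j) ω) ⟨
  step N (λ j → if d ≡ᵇ j then ω else 0) (suc j) ∎
  where open ≡-Reasoning

sum-scaled-spread≡step-Coef : ∀ (s ω : X → ℕ) N k ys →
  sum (map (λ y → ω y * spread N (ind k) (s y)) ys) ≡ step N (Coef s ω ys) k
sum-scaled-spread≡step-Coef s ω N k []       = sym (step-zero N k)
sum-scaled-spread≡step-Coef s ω N k (y ∷ ys) = begin
  ω y * spread N (ind k) (s y) + sum (map (λ y → ω y * spread N (ind k) (s y)) ys)
    ≡⟨ cong₂ _+_ (scaled-spread≡step N (ω y) (s y) k) (sum-scaled-spread≡step-Coef s ω N k ys) ⟩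
  step N (λ j → if s y ≡ᵇ j then ω y else 0) k + step N (Coef s ω ys) k
    ≡⟨ step-+ N (λ j → if s y ≡ᵇ j then ω y else 0) (Coef s ω ys) k ⟨
  step N (Coef s ω (y ∷ ys)) k ∎
  where open ≡-Reasoning

-- Stirling permutations

insertPair : ℕ → Word → List Word
insertPair m []      = [ m ∷ m ∷ [] ]
insertPair m (y ∷ w) = (m ∷ m ∷ y ∷ w) ∷ map (y ∷_) (insertPair m w)

-- des = desAfter 0, definitionally.
desAfter : ℕ → Word → ℕ
desAfter a w = descents (a ∷ w ++ [ 0 ])

desAfter-≤ : ∀ a w → desAfter a w ≤ suc (length w)
desAfter-≤ a []      with 0 <ᵇ a
... | true  = ≤-refl
... | false = z≤n
desAfter-≤ a (y ∷ w) with y <ᵇ a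
... | true  = s≤s (desAfter-≤ y w)
... | false = m≤n⇒m≤1+n (desAfter-≤ y w)

-- Inserting m m into the gap after a descent keeps the number of descents, inserting it
-- into any other gap adds one.
sum-map-desAfter-insertPair : ∀ (f : ℕ → ℕ) {m} a w → a < m → All (_< m) w →
  sum (map (f ∘ desAfter a) (insertPair m w)) ≡ spread (suc (length w)) f (desAfter a w)
sum-map-desAfter-insertPair f {m} a [] a<m []
  rewrite ≥⇒<ᵇ-false (<⇒≤ a<m) | ≥⇒<ᵇ-false (≤-refl {m}) | <⇒<ᵇ-true (<-≤-trans z<s a<m)
  with 0 <ᵇ a
... | true  = cong (_+ 0) (sym (+-identityʳ (f 1)))
... | false = refl
sum-map-desAfter-insertPair f {m} a (y ∷ w) a<m (y<m ∷ w<m)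
  rewrite ≥⇒<ᵇ-false (<⇒≤ a<m) | ≥⇒<ᵇ-false (≤-refl {m}) | <⇒<ᵇ-true y<m
        | sym (map-∘ {g = f ∘ desAfter a} {f = y ∷_} (insertPair m w))
  with y <ᵇ a
... | true  = begin
  f (suc D) + sum (map (f ∘ suc ∘ desAfter y) (insertPair m w))
    ≡⟨ cong (f (suc D) +_) (sum-map-desAfter-insertPair (f ∘ suc) y w y<m w<m) ⟩
  f (suc D) + (D * f (suc D) + (suc (length w) ∸ D) * f (suc (suc D)))
    ≡⟨ +-assoc (f (suc D)) _ _ ⟨
  suc D * f (suc D) + (suc (length w) ∸ D) * f (suc (suc D)) ∎
  where
  open ≡-Reasoning
  D : ℕ
  D = desAfter y w
... | false = begin
  f (suc D) + sum (map (f ∘ desAfter y) (insertPair m w))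
    ≡⟨ cong (f (suc D) +_) (sum-map-desAfter-insertPair f y w y<m w<m) ⟩
  f (suc D) + (D * f D + (suc (length w) ∸ D) * f (suc D))
    ≡⟨ x∙yz≈y∙xz (f (suc D)) (D * f D) _ ⟩
  D * f D + suc (suc (length w) ∸ D) * f (suc D)
    ≡⟨ cong (λ g → D * f D + g * f (suc D)) (+-∸-assoc 1 (desAfter-≤ y w)) ⟨
  D * f D + (suc (suc (length w)) ∸ D) * f (suc D) ∎
  where
  open ≡-Reasoning
  D : ℕ
  D = desAfter y w

occ : ℕ → Word → ℕ
occ c w = length (filter (_≟ c) w)

occ-++ : ∀ c xs ys → occ c (xs ++ ys) ≡ occ c xs + occ c ys
occ-++ c xs ys = trans (cong length (filter-++ (_≟ c) xs ys)) (length-++ (filter (_≟ c) xs))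

occ-here : ∀ c xs → occ c (c ∷ xs) ≡ suc (occ c xs)
occ-here c xs = cong length (filter-accept (_≟ c) {xs = xs} refl)

occ-there : ∀ {c d} xs → d ≢ c → occ c (d ∷ xs) ≡ occ c xs
occ-there {c} xs d≢c = cong length (filter-reject (_≟ c) {xs = xs} d≢c)

∉⇒occ≡0 : ∀ {c} xs → All (_≢ c) xs → occ c xs ≡ 0
∉⇒occ≡0 {c} xs c∉xs = cong length (filter-none (_≟ c) c∉xs)

occ≡0⇒∉ : ∀ c xs → occ c xs ≡ 0 → All (_≢ c) xs
occ≡0⇒∉ c []       _ = []
occ≡0⇒∉ c (x ∷ xs) occ≡0 with x ≟ c
... | yes refl = ⊥-elim (1+n≢0 (trans (sym (occ-here c xs)) occ≡0))
... | no  x≢c  = x≢c ∷ occ≡0⇒∉ c xs (trans (sym (occ-there xs x≢c)) occ≡0)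

occ-after-first : ∀ {c k} u {r} → All (_≢ c) u → occ c (u ++ c ∷ r) ≡ suc k → occ c r ≡ k
occ-after-first {c} u {r} c∉u occ≡ = suc-injective (begin
  suc (occ c r)              ≡⟨ occ-here c r ⟨
  occ c (c ∷ r)              ≡⟨ cong (_+ occ c (c ∷ r)) (∉⇒occ≡0 u c∉u) ⟨
  occ c u + occ c (c ∷ r)    ≡⟨ occ-++ c u (c ∷ r) ⟨
  occ c (u ++ c ∷ r)         ≡⟨ occ≡ ⟩
  suc _                      ∎)
  where open ≡-Reasoning

split-first : ∀ c w → 1 ≤ occ c w → ∃₂ λ u r → w ≡ u ++ c ∷ r × All (_≢ c) u
split-first c []      ()
split-first c (x ∷ w) 1≤occ with x ≟ c
... | yes refl = [] , w , refl , []
... | no  x≢c with split-first c w (subst (1 ≤_) (occ-there w x≢c) 1≤occ)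
...   | u , r , refl , c∉u = x ∷ u , r , refl , x≢c ∷ c∉u

-- NestedByPosition w is the field Stirling.nested; NestedAt y w is the same condition for
-- the letter y, phrased by splitting w instead of by positions.
NestedAt : ℕ → Word → Set
NestedAt y w = ∀ a b c → w ≡ a ++ y ∷ b ++ y ∷ c → All (y ≤_) b

NestedByPosition : Word → Set
NestedByPosition w = (p q r : Fin (length w)) → p Fin.< q → q Fin.< r →
  lookup w p ≡ lookup w r → lookup w p ≤ lookup w q

index-of-split : ∀ (w a : Word) z rest → w ≡ a ++ z ∷ rest →
  Σ (Fin (length w)) λ i → toℕ i ≡ length a × lookup w i ≡ z
index-of-split _ []      z rest refl = Fin.zero , refl , refl
index-of-split _ (x ∷ a) z rest refl with index-of-split (a ++ z ∷ rest) a z rest refl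
... | i , i≡a , wᵢ≡z = Fin.suc i , cong suc i≡a , wᵢ≡z

NestedByPosition⇒NestedAt : ∀ {w} → NestedByPosition w → ∀ y → NestedAt y w
NestedByPosition⇒NestedAt {w} nested y a b c w≡ = All.tabulate inner
  where
  inner : ∀ {z} → z ∈ b → y ≤ z
  inner {z} z∈b with ∈-∃++ z∈b
  ... | b₁ , b₂ , refl
    with index-of-split w a y (b ++ y ∷ c) w≡
       | index-of-split w (a ++ y ∷ b₁) _ (b₂ ++ y ∷ c)
           (trans w≡ (trans (cong (λ t → a ++ y ∷ t) (++-assoc b₁ (_ ∷ b₂) (y ∷ c)))
                            (sym (++-assoc a (y ∷ b₁) (_ ∷ b₂ ++ y ∷ c)))))
       | index-of-split w (a ++ y ∷ b) y c (trans w≡ (sym (++-assoc a (y ∷ b) (y ∷ c))))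
  ... | p , p≡ , wₚ | q , q≡ , w_q | r , r≡ , wᵣ =
    subst₂ _≤_ wₚ w_q (nested p q r p<q q<r (trans wₚ (sym wᵣ)))
    where
    p<q : p Fin.< q
    p<q rewrite p≡ | q≡ | length-++ a {y ∷ b₁} = m<m+n (length a) z<s
    q<r : q Fin.< r
    q<r rewrite q≡ | r≡ | length-++ a {y ∷ b₁} | length-++ a {y ∷ b} | length-++ b₁ {z ∷ b₂} =
      +-monoʳ-< (length a) (s≤s (m<m+n (length b₁) z<s))

split-at : (w : Word) (r : Fin (length w)) → ∃₂ λ b c → w ≡ b ++ lookup w r ∷ c
split-at (x ∷ w) Fin.zero    = [] , w , refl
split-at (x ∷ w) (Fin.suc r) with split-at w r
... | b , c , eq = x ∷ b , c , cong (x ∷_) eq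

split-after : (w : Word) (q r : Fin (length w)) → q Fin.< r →
  ∃₂ λ b c → w ≡ b ++ lookup w r ∷ c × lookup w q ∈ b
split-after (x ∷ w) Fin.zero (Fin.suc r) _ with split-at w r
... | b , c , eq = x ∷ b , c , cong (x ∷_) eq , here refl
split-after (x ∷ w) (Fin.suc q) (Fin.suc r) (s≤s q<r) with split-after w q r q<r
... | b , c , eq , q∈b = x ∷ b , c , cong (x ∷_) eq , there q∈b

split-between : (w : Word) (p q r : Fin (length w)) → p Fin.< q → q Fin.< r →
  ∃₂ λ a b → ∃ λ c → w ≡ a ++ lookup w p ∷ b ++ lookup w r ∷ c × lookup w q ∈ b
split-between (x ∷ w) Fin.zero (Fin.suc q) (Fin.suc r) _ (s≤s q<r) with split-after w q r q<r
... | b , c , eq , q∈b = [] , b , c , cong (x ∷_) eq , q∈b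
split-between (x ∷ w) (Fin.suc p) (Fin.suc q) (Fin.suc r) (s≤s p<q) (s≤s q<r)
  with split-between w p q r p<q q<r
... | a , b , c , eq , q∈b = x ∷ a , b , c , cong (x ∷_) eq , q∈b

NestedAt⇒NestedByPosition : ∀ {w} → (∀ y → NestedAt y w) → NestedByPosition w
NestedAt⇒NestedByPosition {w} nested p q r p<q q<r wₚ≡wᵣ with split-between w p q r p<q q<r
... | a , b , c , eq , q∈b =
  All.lookup (nested (lookup w p) a b c (trans eq (cong (λ z → a ++ _ ∷ b ++ z ∷ c) (sym wₚ≡wᵣ)))) q∈b

NestedAt-tail : ∀ {y x w} → NestedAt y (x ∷ w) → NestedAt y w
NestedAt-tail {x = x} nested a b c eq = nested (x ∷ a) b c (cong (x ∷_) eq)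

NestedAt-delete : ∀ {y} u {e v} → NestedAt y (u ++ e ∷ v) → NestedAt y (u ++ v)
NestedAt-delete []      nested = NestedAt-tail nested
NestedAt-delete (x ∷ u) nested (_ ∷ a) b c eq with ∷-injective eq
... | refl , eq′ = NestedAt-delete u (NestedAt-tail nested) a b c eq′
NestedAt-delete {y} (x ∷ u) {e} {v} nested [] b c eq with ∷-injective eq
... | refl , eq′ with ++-split u v b (y ∷ c) eq′
... | inj₁ (t , refl , refl) =
  All-delete u (nested [] (u ++ e ∷ t) c (cong (y ∷_) (sym (++-assoc u (e ∷ t) (y ∷ c)))))
... | inj₂ ([] , refl , refl) =
  subst (All (y ≤_)) (++-identityʳ b)
    (++⁻ˡ (b ++ []) (nested [] ((b ++ []) ++ [ e ]) c (cong (y ∷_) (sym (++-assoc (b ++ []) [ e ] (y ∷ c))))))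
... | inj₂ (.y ∷ t , refl , refl) =
  nested [] b (t ++ e ∷ v) (cong (y ∷_) (++-assoc b (y ∷ t) (e ∷ v)))

NestedAt-insert : ∀ {y} u {e v} → y < e → NestedAt y (u ++ v) → NestedAt y (u ++ e ∷ v)
NestedAt-insert []      y<e nested []      b c eq with ∷-injective eq
... | refl , _ = ⊥-elim (<-irrefl refl y<e)
NestedAt-insert []      y<e nested (_ ∷ a) b c eq with ∷-injective eq
... | refl , eq′ = nested a b c eq′
NestedAt-insert (x ∷ u) y<e nested (_ ∷ a) b c eq with ∷-injective eq
... | refl , eq′ = NestedAt-insert u y<e (NestedAt-tail nested) a b c eq′
NestedAt-insert {y} (x ∷ u) {e} {v} y<e nested [] b c eq with ∷-injective eq
... | refl , eq′ with ++-split u (e ∷ v) b (y ∷ c) eq′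
... | inj₁ ([] , refl , e∷v≡) = ⊥-elim (<-irrefl (sym (proj₁ (∷-injective e∷v≡))) y<e)
... | inj₁ (.e ∷ t , refl , refl) =
  All-insert u (<⇒≤ y<e) (nested [] (u ++ t) c (cong (y ∷_) (sym (++-assoc u t (y ∷ c)))))
... | inj₂ ([] , refl , y∷c≡) = ⊥-elim (<-irrefl (proj₁ (∷-injective y∷c≡)) y<e)
... | inj₂ (.y ∷ t , refl , refl) = nested [] b (t ++ v) (cong (y ∷_) (++-assoc b (y ∷ t) v))

NestedAt-absent : ∀ {y w} → All (_≢ y) w → NestedAt y w
NestedAt-absent {y} y∉w a b c refl = ⊥-elim (All.lookup y∉w (∈-++⁺ʳ a (here refl)) refl)

∈-tail-of-pattern : ∀ {x y : ℕ} {v} a {b c} → x ∷ v ≡ a ++ y ∷ b ++ y ∷ c → y ∈ v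
∈-tail-of-pattern []      {b} eq with ∷-injective eq
... | _ , refl = ∈-++⁺ʳ b (here refl)
∈-tail-of-pattern (_ ∷ a)     eq with ∷-injective eq
... | _ , refl = ∈-++⁺ʳ a (here refl)

NestedAt-adjacent : ∀ u {m v} → All (_≢ m) u → All (_≢ m) v → NestedAt m (u ++ m ∷ m ∷ v)
NestedAt-adjacent []      m∉u       m∉v []      []      c eq = []
NestedAt-adjacent []      m∉u       m∉v []      (_ ∷ b) c eq with ∷-injective (proj₂ (∷-injective eq))
... | _ , refl = ⊥-elim (All.lookup m∉v (∈-++⁺ʳ b (here refl)) refl)
NestedAt-adjacent []      m∉u       m∉v (_ ∷ a) b       c eq =
  ⊥-elim (All.lookup m∉v (∈-tail-of-pattern a (proj₂ (∷-injective eq))) refl)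
NestedAt-adjacent (_ ∷ u) (x≢m ∷ _) m∉v []      b       c eq = ⊥-elim (x≢m (proj₁ (∷-injective eq)))
NestedAt-adjacent (_ ∷ u) (_ ∷ m∉u) m∉v (_ ∷ a) b       c eq =
  NestedAt-adjacent u m∉u m∉v a b c (proj₂ (∷-injective eq))

length-insertPair : ∀ (u : Word) m v → length (u ++ m ∷ m ∷ v) ≡ 2 + length (u ++ v)
length-insertPair u m v = begin
  length (u ++ m ∷ m ∷ v)        ≡⟨ length-++ u ⟩
  length u + (2 + length v)      ≡⟨ +-suc (length u) _ ⟩
  suc (length u + suc (length v)) ≡⟨ cong suc (+-suc (length u) _) ⟩
  2 + (length u + length v)      ≡⟨ cong (2 +_) (length-++ u) ⟨
  2 + length (u ++ v)            ∎
  where open ≡-Reasoning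

occ-insertPair-≢ : ∀ {i m} u v → m ≢ i → occ i (u ++ m ∷ m ∷ v) ≡ occ i (u ++ v)
occ-insertPair-≢ {i} {m} u v m≢i = begin
  occ i (u ++ m ∷ m ∷ v)     ≡⟨ occ-++ i u _ ⟩
  occ i u + occ i (m ∷ m ∷ v) ≡⟨ cong (occ i u +_) (trans (occ-there _ m≢i) (occ-there v m≢i)) ⟩
  occ i u + occ i v          ≡⟨ occ-++ i u v ⟨
  occ i (u ++ v)             ∎
  where open ≡-Reasoning

occ-insertPair : ∀ m u v → occ m (u ++ m ∷ m ∷ v) ≡ occ m u + (2 + occ m v)
occ-insertPair m u v = trans (occ-++ m u _) (cong (occ m u +_) (trans (occ-here m _) (cong suc (occ-here m v))))

all-equal-absent⇒[] : ∀ {m} b → All (m ≤_) b → All (_≤ m) b → All (_≢ m) b → b ≡ []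
all-equal-absent⇒[] []      _             _             _           = refl
all-equal-absent⇒[] (x ∷ b) (m≤x ∷ _) (x≤m ∷ _) (x≢m ∷ _) = ⊥-elim (x≢m (≤-antisym x≤m m≤x))

Stirling⇒≢suc : ∀ {n w} → Stirling n w → All (_≢ suc n) w
Stirling⇒≢suc st = All.map (λ (_ , a≤n) → <⇒≢ (s≤s a≤n)) (Stirling.letters st)

module _ {n : ℕ} where

  private
    m : ℕ
    m = suc n

  Stirling-insertPair : ∀ u v → Stirling n (u ++ v) → Stirling m (u ++ m ∷ m ∷ v)
  Stirling-insertPair u v st = record
    { len     = trans (length-insertPair u m v) (trans (cong (2 +_) len) (sym (*-suc 2 n)))
    ; letters = All-insert u (s≤s z≤n , ≤-refl) (All-insert u (s≤s z≤n , ≤-refl)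
                  (All.map (λ (1≤a , a≤n) → 1≤a , m≤n⇒m≤1+n a≤n) letters))
    ; twice   = All.tabulate (λ i∈ → twice′ (∈-oneTo⁻ i∈))
    ; nested  = NestedAt⇒NestedByPosition nestedAt
    }
    where
    open Stirling st
    m∉u : All (_≢ m) u
    m∉u = ++⁻ˡ u (Stirling⇒≢suc st)
    m∉v : All (_≢ m) v
    m∉v = ++⁻ʳ u (Stirling⇒≢suc st)
    twice′ : ∀ {i} → 1 ≤ i × i ≤ m → occ i (u ++ m ∷ m ∷ v) ≡ 2
    twice′ {i} (1≤i , i≤m) with i ≟ m
    ... | yes refl = trans (occ-insertPair m u v) (cong₂ (λ a b → a + (2 + b)) (∉⇒occ≡0 u m∉u) (∉⇒occ≡0 v m∉v))
    ... | no  i≢m  = trans (occ-insertPair-≢ u v (i≢m ∘ sym))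
                           (All.lookup twice (∈-oneTo⁺ 1≤i (m<1+n⇒m≤n (≤∧≢⇒< i≤m i≢m))))
    nestedAt : ∀ y → NestedAt y (u ++ m ∷ m ∷ v)
    nestedAt y with <-cmp y m
    ... | tri< y<m _ _ = NestedAt-insert u y<m (NestedAt-insert u y<m (NestedByPosition⇒NestedAt nested y))
    ... | tri≈ _ refl _ = NestedAt-adjacent u m∉u m∉v
    ... | tri> _ _ y>m = NestedAt-absent (All-insert u (<⇒≢ y>m) (All-insert u (<⇒≢ y>m)
                            (All.map (λ (_ , a≤n) → <⇒≢ (≤-<-trans (m≤n⇒m≤1+n a≤n) y>m)) letters)))

  occ-top : ∀ {x} → Stirling m x → occ m x ≡ 2
  occ-top st = All.lookup (Stirling.twice st) (∈-oneTo⁺ (s≤s z≤n) ≤-refl)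

  -- The letters between the two copies of m are ≥ m by nesting and ≤ m, yet differ from m.
  Stirling⇒adjacent : ∀ x → Stirling m x → ∃₂ λ u v → x ≡ u ++ m ∷ m ∷ v × All (_≢ m) (u ++ v)
  Stirling⇒adjacent x st
    with split-first m x (≤-trans (s≤s z≤n) (≤-reflexive (sym (occ-top st))))
  ... | u , r , refl , m∉u
    with split-first m r (≤-reflexive (sym (occ-after-first u m∉u (occ-top st))))
  ... | b , v , refl , m∉b
    with all-equal-absent⇒[] b (NestedByPosition⇒NestedAt (Stirling.nested st) m u b v refl)
                    (All.map proj₂ (++⁻ˡ b (All.tail (++⁻ʳ u (Stirling.letters st))))) m∉b
  ... | refl = u , v , refl ,
    ++⁺ m∉u (occ≡0⇒∉ m v (occ-after-first b m∉b (occ-after-first u m∉u (occ-top st))))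

  Stirling-deletePair : ∀ u v → Stirling m (u ++ m ∷ m ∷ v) → All (_≢ m) (u ++ v) → Stirling n (u ++ v)
  Stirling-deletePair u v st m∉uv = record
    { len     = suc-injective (suc-injective (trans (sym (length-insertPair u m v)) (trans len (*-suc 2 n))))
    ; letters = All.zipWith (λ ((1≤a , a≤m) , a≢m) → 1≤a , m<1+n⇒m≤n (≤∧≢⇒< a≤m a≢m))
                  (All-delete u (All-delete u letters) , m∉uv)
    ; twice   = All.tabulate (λ i∈ → twice′ (∈-oneTo⁻ i∈))
    ; nested  = NestedAt⇒NestedByPosition (λ y →
                  NestedAt-delete u (NestedAt-delete u (NestedByPosition⇒NestedAt nested y)))
    }
    where
    open Stirling st
    twice′ : ∀ {i} → 1 ≤ i × i ≤ n → occ i (u ++ v) ≡ 2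
    twice′ (1≤i , i≤n) = trans (sym (occ-insertPair-≢ u v (<⇒≢ (s≤s i≤n) ∘ sym)))
                               (All.lookup twice (∈-oneTo⁺ 1≤i (m≤n⇒m≤1+n i≤n)))

removeAll-insertPair : ∀ {m} u v → All (_≢ m) (u ++ v) → removeAll m (u ++ m ∷ m ∷ v) ≡ u ++ v
removeAll-insertPair {m} u v m∉uv = begin
  removeAll m (u ++ m ∷ m ∷ v)               ≡⟨ filter-++ ≢m? u (m ∷ m ∷ v) ⟩
  removeAll m u ++ removeAll m (m ∷ m ∷ v)   ≡⟨ cong (removeAll m u ++_) (trans (filter-reject ≢m? (λ m≢m → m≢m refl))
                                                                                 (filter-reject ≢m? (λ m≢m → m≢m refl))) ⟩
  removeAll m u ++ removeAll m v             ≡⟨ cong₂ _++_ (removeAll-∉ u (++⁻ˡ u m∉uv)) (removeAll-∉ v (++⁻ʳ u m∉uv)) ⟩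
  u ++ v                                     ∎
  where
  open ≡-Reasoning
  ≢m? : (a : ℕ) → Dec (a ≢ m)
  ≢m? = λ a → ¬? (a ≟ m)

∈-insertPair⁻ : ∀ m w {x} → x ∈ insertPair m w → ∃₂ λ u v → w ≡ u ++ v × x ≡ u ++ m ∷ m ∷ v
∈-insertPair⁻ m []      (here refl) = [] , [] , refl , refl
∈-insertPair⁻ m (y ∷ w) (here refl) = [] , y ∷ w , refl , refl
∈-insertPair⁻ m (y ∷ w) (there x∈) with ∈-map⁻ (y ∷_) x∈
... | x′ , x′∈ , refl with ∈-insertPair⁻ m w x′∈
... | u , v , refl , refl = y ∷ u , v , refl , refl

∈-insertPair⁺ : ∀ m u v → (u ++ m ∷ m ∷ v) ∈ insertPair m (u ++ v)
∈-insertPair⁺ m []      []      = here refl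
∈-insertPair⁺ m []      (y ∷ v) = here refl
∈-insertPair⁺ m (y ∷ u) v       = there (∈-map⁺ (y ∷_) (∈-insertPair⁺ m u v))

insertPair-unique : ∀ m w → All (_≢ m) w → Unique (insertPair m w)
insertPair-unique m []      _            = [] ∷ []
insertPair-unique m (y ∷ w) (y≢m ∷ m∉w) =
  All.tabulate head-fresh ∷ Unique.map⁺ (proj₂ ∘ ∷-injective) (insertPair-unique m w m∉w)
  where
  head-fresh : ∀ {x} → x ∈ map (y ∷_) (insertPair m w) → m ∷ m ∷ y ∷ w ≢ x
  head-fresh x∈ refl with ∈-map⁻ (y ∷_) x∈
  ... | _ , _ , eq = y≢m (sym (proj₁ (∷-injective eq)))

stirlings : ℕ → List Word
stirlings zero    = [ [] ]
stirlings (suc n) = concatMap (insertPair (suc n)) (stirlings n)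

Stirling-zero : Stirling 0 []
Stirling-zero = record { len = refl ; letters = [] ; twice = [] ; nested = λ () }

Stirling-zero⁻ : ∀ x → Stirling 0 x → x ≡ []
Stirling-zero⁻ []      _  = refl
Stirling-zero⁻ (_ ∷ _) st with Stirling.len st
... | ()

∈-stirlings⇔ : ∀ n x → (x ∈ stirlings n) ⇔ Stirling n x
∈-stirlings⇔ zero    x = mk⇔ (λ { (here refl) → Stirling-zero }) (here ∘ Stirling-zero⁻ x)
∈-stirlings⇔ (suc n) x = mk⇔ to from
  where
  to : x ∈ stirlings (suc n) → Stirling (suc n) x
  to x∈ with ∈-concatMap⁻′ (insertPair (suc n)) x∈
  ... | w , w∈ , x∈′ with ∈-insertPair⁻ (suc n) w x∈′
  ... | u , v , refl , refl = Stirling-insertPair u v (Equivalence.to (∈-stirlings⇔ n (u ++ v)) w∈)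
  from : Stirling (suc n) x → x ∈ stirlings (suc n)
  from st with Stirling⇒adjacent x st
  ... | u , v , refl , m∉uv =
    ∈-concatMap⁺′ (insertPair (suc n))
      (Equivalence.from (∈-stirlings⇔ n (u ++ v)) (Stirling-deletePair u v st m∉uv)) (∈-insertPair⁺ (suc n) u v)

stirlings-Stirling : ∀ n → All (Stirling n) (stirlings n)
stirlings-Stirling n = All.tabulate (Equivalence.to (∈-stirlings⇔ n _))

stirlings-unique : ∀ n → Unique (stirlings n)
stirlings-unique zero    = [] ∷ []
stirlings-unique (suc n) =
  concatMap-unique (insertPair (suc n)) (stirlings-unique n) (stirlings-Stirling n)
    (λ st → insertPair-unique (suc n) _ (Stirling⇒≢suc st)) same-parent
  where
  same-parent : ∀ {w w′ x} → Stirling n w → Stirling n w′ →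
    x ∈ insertPair (suc n) w → x ∈ insertPair (suc n) w′ → w ≡ w′
  same-parent {w} {w′} st st′ x∈ x∈′
    with ∈-insertPair⁻ (suc n) w x∈ | ∈-insertPair⁻ (suc n) w′ x∈′
  ... | u , v , refl , refl | u′ , v′ , refl , x≡ =
    trans (sym (removeAll-insertPair u v (Stirling⇒≢suc st)))
          (trans (cong (removeAll (suc n)) x≡) (removeAll-insertPair u′ v′ (Stirling⇒≢suc st′)))

CCoeff-stirlings-suc : ∀ n k → CCoeff (stirlings (suc n)) k ≡ step (suc (2 * n)) (CCoeff (stirlings n)) k
CCoeff-stirlings-suc n k = begin
  CCoeff (stirlings (suc n)) k
    ≡⟨ sum-map-concatMap (ind k ∘ des) (insertPair (suc n)) (stirlings n) ⟩
  sum (map (λ w → sum (map (ind k ∘ des) (insertPair (suc n) w))) (stirlings n))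
    ≡⟨ sum-map-congᴬ _ _ (stirlings-Stirling n) children ⟩
  sum (map (λ w → 1 * spread (suc (2 * n)) (ind k) (des w)) (stirlings n))
    ≡⟨ sum-scaled-spread≡step-Coef des (λ _ → 1) (suc (2 * n)) k (stirlings n) ⟩
  step (suc (2 * n)) (CCoeff (stirlings n)) k ∎
  where
  open ≡-Reasoning
  children : ∀ {w} → Stirling n w →
    sum (map (ind k ∘ des) (insertPair (suc n) w)) ≡ 1 * spread (suc (2 * n)) (ind k) (des w)
  children {w} st = begin
    sum (map (ind k ∘ des) (insertPair (suc n) w))
      ≡⟨ sum-map-desAfter-insertPair (ind k) 0 w z<s (All.map (λ (_ , a≤n) → s≤s a≤n) (Stirling.letters st)) ⟩
    spread (suc (length w)) (ind k) (des w)
      ≡⟨ cong (λ l → spread (suc l) (ind k) (des w)) (Stirling.len st) ⟩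
    spread (suc (2 * n)) (ind k) (des w)
      ≡⟨ *-identityˡ _ ⟨
    1 * spread (suc (2 * n)) (ind k) (des w) ∎

-- Standard Young tableaux

-- Rows are listed bottom row first; b is the length of the row
-- below the first row of T.
data AddMax (m : ℕ) : ℕ → Tableau → Tableau → Set where
  newRow : ∀ {b} → AddMax m b [] [ [ m ] ]
  append : ∀ {b r T} → length r < b → AddMax m b (r ∷ T) ((r ++ [ m ]) ∷ T)
  skip   : ∀ {b r T x} → AddMax m (length r) T x → AddMax m b (r ∷ T) (r ∷ x)

addMax : ℕ → ℕ → Tableau → List Tableau
addMax m b []      = [ [ [ m ] ] ]
addMax m b (r ∷ T) =
  (if length r <ᵇ b then [ (r ++ [ m ]) ∷ T ] else []) ++ map (r ∷_) (addMax m (length r) T)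

∈-addMax⁻ : ∀ m b T {x} → x ∈ addMax m b T → AddMax m b T x
∈-addMax⁻ m b []      (here refl) = newRow
∈-addMax⁻ m b (r ∷ T) x∈ with length r <ᵇ b in r<b
∈-addMax⁻ m b (r ∷ T) (here refl) | true = append (<ᵇ-true⇒< r<b)
∈-addMax⁻ m b (r ∷ T) (there x∈)  | true with ∈-map⁻ (r ∷_) x∈
... | _ , x∈′ , refl = skip (∈-addMax⁻ m (length r) T x∈′)
∈-addMax⁻ m b (r ∷ T) x∈          | false with ∈-map⁻ (r ∷_) x∈
... | _ , x∈′ , refl = skip (∈-addMax⁻ m (length r) T x∈′)

∈-addMax⁺ : ∀ {m b T x} → AddMax m b T x → x ∈ addMax m b T
∈-addMax⁺ newRow = here refl
∈-addMax⁺ (append r<b) rewrite <⇒<ᵇ-true r<b = here refl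
∈-addMax⁺ {b = b} {r ∷ T} (skip add) with length r <ᵇ b
... | true  = there (∈-map⁺ (r ∷_) (∈-addMax⁺ add))
... | false = ∈-map⁺ (r ∷_) (∈-addMax⁺ add)

addMax-unique : ∀ m b T → Unique (addMax m b T)
addMax-unique m b []      = [] ∷ []
addMax-unique m b (r ∷ T) with length r <ᵇ b
... | false = Unique.map⁺ (proj₂ ∘ ∷-injective) (addMax-unique m (length r) T)
... | true  = All.tabulate head-fresh ∷ Unique.map⁺ (proj₂ ∘ ∷-injective) (addMax-unique m (length r) T)
  where
  head-fresh : ∀ {x} → x ∈ map (r ∷_) (addMax m (length r) T) → (r ++ [ m ]) ∷ T ≢ x
  head-fresh x∈ refl with ∈-map⁻ (r ∷_) x∈
  ... | _ , _ , eq = 1+n≰n (≤-reflexive (trans (sym (length-snoc r m)) (cong length (proj₁ (∷-injective eq)))))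

removeMax : ℕ → Tableau → Tableau
removeMax m []      = []
removeMax m (r ∷ T) with removeAll m r
... | []    = removeMax m T
... | a ∷ s = (a ∷ s) ∷ removeMax m T

removeMax-∉ : ∀ {m} T → All (_≢ []) T → All (All (_≢ m)) T → removeMax m T ≡ T
removeMax-∉ [] _ _ = refl
removeMax-∉ {m} (r ∷ T) (r≢[] ∷ T≢[]) (m∉r ∷ m∉T) with removeAll m r | removeAll-∉ r m∉r
... | []    | refl = ⊥-elim (r≢[] refl)
... | a ∷ s | refl = cong (r ∷_) (removeMax-∉ T T≢[] m∉T)

removeMax-AddMax : ∀ {m b T x} → AddMax m b T x → All (_≢ []) T → All (All (_≢ m)) T → removeMax m x ≡ T
removeMax-AddMax {m} newRow _ _ rewrite filter-reject (λ a → ¬? (a ≟ m)) {x = m} {xs = []} (λ m≢m → m≢m refl) = refl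
removeMax-AddMax {m} (append {r = r} {T} _) (r≢[] ∷ T≢[]) (m∉r ∷ m∉T)
  with removeAll m (r ++ [ m ]) | removeAll-snoc r m∉r
... | []    | refl = ⊥-elim (r≢[] refl)
... | a ∷ s | refl = cong (r ∷_) (removeMax-∉ T T≢[] m∉T)
removeMax-AddMax {m} (skip {r = r} add) (r≢[] ∷ T≢[]) (m∉r ∷ m∉T) with removeAll m r | removeAll-∉ r m∉r
... | []    | refl = ⊥-elim (r≢[] refl)
... | a ∷ s | refl = cong (r ∷_) (removeMax-AddMax add T≢[] m∉T)

ColOKFirst : List ℕ → Tableau → Set
ColOKFirst lo []      = ⊤
ColOKFirst lo (r ∷ _) = ColOK lo r

Linked-cons : ∀ {lo T} → ColOKFirst lo T → Linked ColOK T → Linked ColOK (lo ∷ T)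
Linked-cons {T = []}    _  _    = [-]
Linked-cons {T = _ ∷ _} ok cols = ok ∷ cols

Linked-first : ∀ {lo T} → Linked ColOK (lo ∷ T) → ColOKFirst lo T
Linked-first [-]      = tt
Linked-first (ok ∷ _) = ok

ColOK-++ˡ : ∀ r s t → ColOK r s → ColOK (r ++ t) s
ColOK-++ˡ r       []      t _          = tt
ColOK-++ˡ (a ∷ r) (b ∷ s) t (a<b , ok) = a<b , ColOK-++ˡ r s t ok

ColOK-++ʳ⁻ : ∀ lo r t → ColOK lo (r ++ t) → ColOK lo r
ColOK-++ʳ⁻ lo       []      t _          = tt
ColOK-++ʳ⁻ (l ∷ lo) (a ∷ r) t (l<a , ok) = l<a , ColOK-++ʳ⁻ lo r t ok

ColOK-snoc : ∀ {m} lo r → ColOK lo r → length r < length lo → All (_< m) lo → ColOK lo (r ++ [ m ])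
ColOK-snoc (l ∷ lo) []      _          _         (l<m ∷ _)  = l<m , tt
ColOK-snoc (l ∷ lo) (a ∷ r) (l<a , ok) (s≤s r<lo) (_ ∷ lo<m) = l<a , ColOK-snoc lo r ok r<lo lo<m

ColOK-unsnoc : ∀ {m} r s → ColOK (r ++ [ m ]) s → All (_≤ m) s → ColOK r s
ColOK-unsnoc r       []      _          _           = tt
ColOK-unsnoc []      (b ∷ s) (m<b , _)  (b≤m ∷ _)   = ⊥-elim (<-irrefl refl (<-≤-trans m<b b≤m))
ColOK-unsnoc (a ∷ r) (b ∷ s) (a<b , ok) (_ ∷ s≤m)   = a<b , ColOK-unsnoc r s ok s≤m

ColOK⇒length≤ : ∀ lo r → ColOK lo r → length r ≤ length lo
ColOK⇒length≤ lo       []      _        = z≤n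
ColOK⇒length≤ (l ∷ lo) (a ∷ r) (_ , ok) = s≤s (ColOK⇒length≤ lo r ok)

Linked-snoc : ∀ {m} r → Linked _<_ r → All (_< m) r → Linked _<_ (r ++ [ m ])
Linked-snoc []          _         _          = [-]
Linked-snoc (a ∷ [])    _         (a<m ∷ _)  = a<m ∷ [-]
Linked-snoc (a ∷ b ∷ r) (a<b ∷ l) (_ ∷ r<m) = a<b ∷ Linked-snoc (b ∷ r) l r<m

Linked-++⁻ˡ : ∀ {R : ℕ → ℕ → Set} r t → Linked R (r ++ t) → Linked R r
Linked-++⁻ˡ []          t _         = []
Linked-++⁻ˡ (a ∷ [])    t _         = [-]
Linked-++⁻ˡ (a ∷ b ∷ r) t (Rab ∷ l) = Rab ∷ Linked-++⁻ˡ (b ∷ r) t l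

∈-increasing-max : ∀ {m} r → Linked _<_ r → All (_≤ m) r → m ∈ r → ∃ λ r₀ → r ≡ r₀ ++ [ m ]
∈-increasing-max (a ∷ [])    _         _               (here refl) = [] , refl
∈-increasing-max (a ∷ b ∷ r) (a<b ∷ _) (_ ∷ b≤a ∷ _)   (here refl) = ⊥-elim (<-irrefl refl (<-≤-trans a<b b≤a))
∈-increasing-max (a ∷ r)     l         (_ ∷ r≤m)       (there m∈r) with ∈-increasing-max r (Linked.tail l) r≤m m∈r
... | r₀ , refl = a ∷ r₀ , refl

record IsTableau (T : Tableau) : Set where
  constructor tableau
  field
    nonempty : All (_≢ []) T
    rowsInc  : All (Linked _<_) T
    colsInc  : Linked ColOK T

FirstRowAtMost : ℕ → Tableau → Set
FirstRowAtMost b []      = ⊤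
FirstRowAtMost b (r ∷ _) = length r ≤ b

module _ {m : ℕ} where

  AddMax-nonempty : ∀ {b T x} → AddMax m b T x → All (_≢ []) T → All (_≢ []) x
  AddMax-nonempty newRow                   _              = (λ ()) ∷ []
  AddMax-nonempty (append {r = []} _)      (_ ∷ T≢[])     = (λ ()) ∷ T≢[]
  AddMax-nonempty (append {r = _ ∷ _} _)   (_ ∷ T≢[])     = (λ ()) ∷ T≢[]
  AddMax-nonempty (skip add)               (r≢[] ∷ T≢[]) = r≢[] ∷ AddMax-nonempty add T≢[]

  AddMax-rowsInc : ∀ {b T x} → AddMax m b T x → All (Linked _<_) T → All (All (_< m)) T → All (Linked _<_) x
  AddMax-rowsInc newRow                 _          _          = [-] ∷ []
  AddMax-rowsInc (append {r = r} _)     (l ∷ ls)   (r<m ∷ _)  = Linked-snoc r l r<m ∷ ls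
  AddMax-rowsInc (skip add)             (l ∷ ls)   (_ ∷ T<m)  = l ∷ AddMax-rowsInc add ls T<m

  AddMax-first : ∀ {b T x} → AddMax m b T x → ∀ lo → length lo ≡ b → 1 ≤ b → All (_< m) lo →
    ColOKFirst lo T → ColOKFirst lo x
  AddMax-first newRow             []      refl ()
  AddMax-first newRow             (l ∷ _) _    _  (l<m ∷ _) _  = l<m , tt
  AddMax-first (append {r = r} r<b) lo   refl _  lo<m      ok = ColOK-snoc lo r ok r<b lo<m
  AddMax-first (skip _)           _       _    _  _         ok = ok

  AddMax-colsInc : ∀ {b T x} → AddMax m b T x → All (_≢ []) T → All (All (_< m)) T →
    Linked ColOK T → Linked ColOK x
  AddMax-colsInc newRow _ _ _ = [-]
  AddMax-colsInc (append {r = r} {T} _) _ _ cols =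
    Linked-cons (above T (Linked-first cols)) (Linked.tail cols)
    where
    above : ∀ T → ColOKFirst r T → ColOKFirst (r ++ [ m ]) T
    above []      _  = tt
    above (s ∷ _) ok = ColOK-++ˡ r s [ m ] ok
  AddMax-colsInc (skip {r = r} add) (r≢[] ∷ T≢[]) (r<m ∷ T<m) cols =
    Linked-cons (AddMax-first add r refl (nonempty⇒1≤length r r≢[]) r<m (Linked-first cols))
                (AddMax-colsInc add T≢[] T<m (Linked.tail cols))

  AddMax-concat : ∀ {b T x} → AddMax m b T x → concat x ↭ m ∷ concat T
  AddMax-concat newRow = ↭-refl
  AddMax-concat (append {r = r} {T} _) =
    ↭-trans (↭-reflexive (++-assoc r [ m ] (concat T))) (Perm.shift m r (concat T))
  AddMax-concat (skip {r = r} {T} add) =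
    ↭-trans (Perm.++⁺ˡ r (AddMax-concat add)) (Perm.shift m r (concat T))

  nothing-above-max : ∀ x → All (_≢ []) x → All (All (_≤ m)) x → ColOKFirst [ m ] x → x ≡ []
  nothing-above-max []            _              _                 _           = refl
  nothing-above-max ([] ∷ _)      (s≢[] ∷ _)     _                 _           = ⊥-elim (s≢[] refl)
  nothing-above-max ((a ∷ _) ∷ _) _              ((a≤m ∷ _) ∷ _)   (m<a , _)   = ⊥-elim (<-irrefl refl (<-≤-trans m<a a≤m))

  -- m ends its row; if it is alone there, that row is the top one, as the row above it
  -- would need an entry larger than m.
  AddMax-inverse : ∀ x b → IsTableau x → All (All (_≤ m)) x → m ∈ concat x → FirstRowAtMost b x →
    Σ Tableau λ T → AddMax m b T x × IsTableau T × (∀ lo → ColOKFirst lo x → ColOKFirst lo T)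
  AddMax-inverse [] b _ _ () _
  AddMax-inverse (r ∷ x) b (tableau (r≢[] ∷ x≢[]) (l ∷ ls) cols) (r≤m ∷ x≤m) m∈ r≤b with m ∈? r
  ... | yes m∈r with ∈-increasing-max r l r≤m m∈r
  ...   | [] , refl with nothing-above-max x x≢[] x≤m (Linked-first cols)
  ...     | refl = [] , newRow , tableau [] [] [] , λ _ _ → tt
  AddMax-inverse (r ∷ x) b (tableau (r≢[] ∷ x≢[]) (l ∷ ls) cols) (r≤m ∷ x≤m) m∈ r≤b
    | yes m∈r | r₀@(_ ∷ _) , refl =
    r₀ ∷ x , append (≤-trans (≤-reflexive (sym (length-snoc r₀ m))) r≤b) ,
    tableau ((λ ()) ∷ x≢[]) (Linked-++⁻ˡ r₀ [ m ] l ∷ ls)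
            (Linked-cons (below x (Linked-first cols) x≤m) (Linked.tail cols)) ,
    λ lo ok → ColOK-++ʳ⁻ lo r₀ [ m ] ok
    where
    below : ∀ x → ColOKFirst (r₀ ++ [ m ]) x → All (All (_≤ m)) x → ColOKFirst r₀ x
    below []      _  _            = tt
    below (s ∷ _) ok (s≤m ∷ _) = ColOK-unsnoc r₀ s ok s≤m
  AddMax-inverse (r ∷ x) b (tableau (r≢[] ∷ x≢[]) (l ∷ ls) cols) (r≤m ∷ x≤m) m∈ r≤b | no m∉r
    with ∈-++⁻ r m∈
  ... | inj₁ m∈r = ⊥-elim (m∉r m∈r)
  ... | inj₂ m∈x
    with AddMax-inverse x (length r) (tableau x≢[] ls (Linked.tail cols)) x≤m m∈x
                        (first-at-most x (Linked-first cols))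
    where
    first-at-most : ∀ x → ColOKFirst r x → FirstRowAtMost (length r) x
    first-at-most []      _  = tt
    first-at-most (s ∷ _) ok = ColOK⇒length≤ r s ok
  ... | T , add , tableau T≢[] Tls Tcols , keeps =
    r ∷ T , skip add , tableau (r≢[] ∷ T≢[]) (l ∷ Tls) (Linked-cons (keeps r (Linked-first cols)) Tcols) ,
    λ _ ok → ok

module _ {n : ℕ} {T : Tableau} (syt : IsSYT n T) where

  open IsSYT syt

  IsSYT⇒IsTableau : IsTableau T
  IsSYT⇒IsTableau = tableau nonempty rowsInc colsInc

  IsSYT-entries : All (All (λ a → 1 ≤ a × a ≤ n)) T
  IsSYT-entries = All.tabulate λ r∈ → All.tabulate λ a∈ → ∈-oneTo⁻ (Perm.∈-resp-↭ entries (∈-concat⁺′ a∈ r∈))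

  IsSYT-size : length (concat T) ≡ n
  IsSYT-size = trans (Perm.↭-length entries) (length-oneTo n)

  IsSYT-<suc : All (All (_< suc n)) T
  IsSYT-<suc = All.map (All.map (λ (_ , a≤n) → s≤s a≤n)) IsSYT-entries

  IsSYT-≢suc : All (All (_≢ suc n)) T
  IsSYT-≢suc = All.map (All.map (λ (_ , a≤n) → <⇒≢ (s≤s a≤n))) IsSYT-entries

  IsSYT-rowLengths : All (λ r → 1 ≤ length r × length r ≤ n) T
  IsSYT-rowLengths = All.zipWith (λ {r} (r≢[] , r≤n) → nonempty⇒1≤length r r≢[] , r≤n)
    (nonempty , All.tabulate (λ r∈T → ≤-trans (length-∈-≤-concat T r∈T) (≤-reflexive IsSYT-size)))

  IsSYT-numRows : length T ≤ n
  IsSYT-numRows = ≤-trans (length≤length-concat T nonempty) (≤-reflexive IsSYT-size)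

  IsSYT-addMax : ∀ {x} → AddMax (suc n) (suc n) T x → IsSYT (suc n) x
  IsSYT-addMax add = record
    { nonempty = AddMax-nonempty add nonempty
    ; rowsInc  = AddMax-rowsInc add rowsInc IsSYT-<suc
    ; colsInc  = AddMax-colsInc add nonempty IsSYT-<suc colsInc
    ; entries  = ↭-trans (AddMax-concat add) (↭-trans (prep (suc n) entries)
                   (↭-trans (Perm.∷↭∷ʳ (suc n) (oneTo n)) (↭-reflexive (sym (oneTo-suc n)))))
    }

first-row-at-most-size : ∀ x → FirstRowAtMost (length (concat x)) x
first-row-at-most-size []      = tt
first-row-at-most-size (r ∷ x) = ≤-trans (m≤m+n (length r) _) (≤-reflexive (sym (length-++ r)))

IsSYT-parent : ∀ {n x} → IsSYT (suc n) x → Σ Tableau λ T → IsSYT n T × AddMax (suc n) (suc n) T x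
IsSYT-parent {n} {x} syt
  with AddMax-inverse x (suc n) (IsSYT⇒IsTableau syt) (All.map (All.map proj₂) (IsSYT-entries syt))
         (Perm.∈-resp-↭ (↭-sym (IsSYT.entries syt)) (∈-oneTo⁺ (s≤s z≤n) ≤-refl))
         (subst (λ b → FirstRowAtMost b x) (IsSYT-size syt) (first-row-at-most-size x))
... | T , add , tableau T≢[] Tinc Tcols , _ =
  T , record { nonempty = T≢[] ; rowsInc = Tinc ; colsInc = Tcols ; entries = entries } , add
  where
  entries : concat T ↭ oneTo n
  entries = Perm.drop-∷ (↭-trans (↭-sym (AddMax-concat add)) (↭-trans (IsSYT.entries syt)
              (↭-trans (↭-reflexive (oneTo-suc n)) (↭-sym (Perm.∷↭∷ʳ (suc n) (oneTo n))))))

syts : ℕ → List Tableau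
syts zero    = [ [] ]
syts (suc n) = concatMap (addMax (suc n) (suc n)) (syts n)

IsSYT-zero : IsSYT 0 []
IsSYT-zero = record { nonempty = [] ; rowsInc = [] ; colsInc = [] ; entries = ↭-refl }

IsSYT-zero⁻ : ∀ T → IsSYT 0 T → T ≡ []
IsSYT-zero⁻ []            _   = refl
IsSYT-zero⁻ ([] ∷ T)      syt = ⊥-elim (All.head (IsSYT.nonempty syt) refl)
IsSYT-zero⁻ ((a ∷ r) ∷ T) syt with Perm.↭-length (IsSYT.entries syt)
... | ()

∈-syts⇔ : ∀ n T → (T ∈ syts n) ⇔ IsSYT n T
∈-syts⇔ zero    T = mk⇔ (λ { (here refl) → IsSYT-zero }) (here ∘ IsSYT-zero⁻ T)
∈-syts⇔ (suc n) x = mk⇔ to from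
  where
  to : x ∈ syts (suc n) → IsSYT (suc n) x
  to x∈ with ∈-concatMap⁻′ (addMax (suc n) (suc n)) x∈
  ... | T , T∈ , x∈′ = IsSYT-addMax (Equivalence.to (∈-syts⇔ n T) T∈) (∈-addMax⁻ (suc n) (suc n) T x∈′)
  from : IsSYT (suc n) x → x ∈ syts (suc n)
  from syt with IsSYT-parent syt
  ... | T , sytT , add =
    ∈-concatMap⁺′ (addMax (suc n) (suc n)) (Equivalence.from (∈-syts⇔ n T) sytT) (∈-addMax⁺ add)

syts-IsSYT : ∀ n → All (IsSYT n) (syts n)
syts-IsSYT n = All.tabulate (Equivalence.to (∈-syts⇔ n _))

syts-unique : ∀ n → Unique (syts n)
syts-unique zero    = [] ∷ []
syts-unique (suc n) =
  concatMap-unique (addMax (suc n) (suc n)) (syts-unique n) (syts-IsSYT n)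
    (λ {T} _ → addMax-unique (suc n) (suc n) T) same-parent
  where
  same-parent : ∀ {T T′ x} → IsSYT n T → IsSYT n T′ →
    x ∈ addMax (suc n) (suc n) T → x ∈ addMax (suc n) (suc n) T′ → T ≡ T′
  same-parent {T} {T′} syt syt′ x∈ x∈′ =
    trans (sym (removeMax-AddMax (∈-addMax⁻ _ _ T x∈) (IsSYT.nonempty syt) (IsSYT-≢suc syt)))
          (removeMax-AddMax (∈-addMax⁻ _ _ T′ x∈′) (IsSYT.nonempty syt′) (IsSYT-≢suc syt′))

product-map-* : (f g : X → ℕ) (xs : List X) →
  product (map (λ a → f a * g a) xs) ≡ product (map f xs) * product (map g xs)
product-map-* f g []       = refl
product-map-* f g (x ∷ xs) rewrite product-map-* f g xs =
  solve 4 (λ a b c d → (a :* b) :* (c :* d) := (a :* c) :* (b :* d)) refl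
    (f x) (g x) (product (map f xs)) (product (map g xs))

product-map-congᴬ : {P : X → Set} (f g : X → ℕ) {xs : List X} → All P xs →
  (∀ {x} → P x → f x ≡ g x) → product (map f xs) ≡ product (map g xs)
product-map-congᴬ f g []         f≗g = refl
product-map-congᴬ f g (px ∷ pxs) f≗g = cong₂ _*_ (f≗g px) (product-map-congᴬ f g pxs f≗g)

product-map-oneTo-suc : ∀ (f : ℕ → ℕ) N → product (map f (oneTo (suc N))) ≡ product (map f (oneTo N)) * f (suc N)
product-map-oneTo-suc f N = begin
  product (map f (oneTo (suc N)))              ≡⟨ cong (λ L → product (map f L)) (oneTo-suc N) ⟩
  product (map f (oneTo N ++ [ suc N ]))       ≡⟨ cong product (map-++ f (oneTo N) [ suc N ]) ⟩
  product (map f (oneTo N) ++ [ f (suc N) ])   ≡⟨ product-++ (map f (oneTo N)) [ f (suc N) ] ⟩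
  product (map f (oneTo N)) * (f (suc N) * 1) ≡⟨ cong (product (map f (oneTo N)) *_) (*-identityʳ (f (suc N))) ⟩
  product (map f (oneTo N)) * f (suc N)       ∎
  where open ≡-Reasoning

product-map-const-1 : (f : X → ℕ) (xs : List X) → All (λ x → f x ≡ 1) xs → product (map f xs) ≡ 1
product-map-const-1 f []       []              = refl
product-map-const-1 f (x ∷ xs) (fx≡1 ∷ fxs≡1) rewrite fx≡1 | product-map-const-1 f xs fxs≡1 = refl

product-factorial-ind : ∀ N L → 1 ≤ L → L ≤ N → product (map (λ i → (i !) ^ ind i L) (oneTo N)) ≡ L !
product-factorial-ind zero    (suc _) _ ()
product-factorial-ind (suc N) L 1≤L L≤N+1
  rewrite product-map-oneTo-suc (λ i → (i !) ^ ind i L) N with L ≟ suc N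
... | yes refl rewrite ≡ᵇ-refl N = begin
  product (map (λ i → (i !) ^ ind i (suc N)) (oneTo N)) * (suc N ! * 1)
    ≡⟨ cong₂ _*_ (product-map-const-1 _ (oneTo N) (All.tabulate below)) (*-identityʳ (suc N !)) ⟩
  1 * suc N !
    ≡⟨ *-identityˡ (suc N !) ⟩
  suc N ! ∎
  where
  open ≡-Reasoning
  below : ∀ {i} → i ∈ oneTo N → (i !) ^ ind i (suc N) ≡ 1
  below i∈ rewrite ≢⇒≡ᵇ-false {suc N} (λ N+1≡i → <-irrefl (sym N+1≡i) (s≤s (proj₂ (∈-oneTo⁻ i∈)))) = refl
... | no L≢N+1 rewrite ≢⇒≡ᵇ-false L≢N+1 =
  trans (*-identityʳ _) (product-factorial-ind N L 1≤L (m<1+n⇒m≤n (≤∧≢⇒< L≤N+1 L≢N+1)))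

rowsOfLength-cons : ∀ i r T → rowsOfLength i (r ∷ T) ≡ ind i (length r) + rowsOfLength i T
rowsOfLength-cons i r T with length r ≟ i
... | yes refl rewrite ≡ᵇ-refl (length r) = refl
... | no  r≢i  rewrite ≢⇒≡ᵇ-false r≢i      = refl

factorials : Tableau → ℕ
factorials T = product (map (λ r → length r !) T)

factorials-++ : ∀ T U → factorials (T ++ U) ≡ factorials T * factorials U
factorials-++ T U = trans (cong product (map-++ _ T U)) (product-++ (map (λ r → length r !) T) _)

product-factorial-rowsOfLength : ∀ N T → All (λ r → 1 ≤ length r × length r ≤ N) T →
  product (map (λ i → (i !) ^ rowsOfLength i T) (oneTo N)) ≡ factorials T
product-factorial-rowsOfLength N []      _ = product-map-const-1 _ (oneTo N) (All.tabulate (λ _ → refl))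
product-factorial-rowsOfLength N (r ∷ T) ((1≤r , r≤N) ∷ T-bounds) = begin
  product (map (λ i → (i !) ^ rowsOfLength i (r ∷ T)) (oneTo N))
    ≡⟨ cong product (map-cong (λ i → trans (cong ((i !) ^_) (rowsOfLength-cons i r T))
                                             (^-distribˡ-+-* (i !) (ind i (length r)) (rowsOfLength i T))) (oneTo N)) ⟩
  product (map (λ i → (i !) ^ ind i (length r) * (i !) ^ rowsOfLength i T) (oneTo N))
    ≡⟨ product-map-* _ _ (oneTo N) ⟩
  product (map (λ i → (i !) ^ ind i (length r)) (oneTo N)) * product (map (λ i → (i !) ^ rowsOfLength i T) (oneTo N))
    ≡⟨ cong₂ _*_ (product-factorial-ind N (length r) 1≤r r≤N) (product-factorial-rowsOfLength N T T-bounds) ⟩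
  length r ! * factorials T ∎
  where open ≡-Reasoning

sigmas : ℕ → Tableau → ℕ
sigmas N T = product (map (λ i → sigma i T) (oneTo N))

weight≡sigmas*factorials : ∀ N T → All (λ r → 1 ≤ length r × length r ≤ N) T →
  weight N T ≡ sigmas N T * factorials T
weight≡sigmas*factorials N T bounds =
  trans (product-map-* (λ i → sigma i T) (λ i → (i !) ^ rowsOfLength i T) (oneTo N))
        (cong (sigmas N T *_) (product-factorial-rowsOfLength N T bounds))

posIn-snoc : ∀ {i m} r → m ≢ i → posIn i (r ++ [ m ]) ≡ posIn i r
posIn-snoc [] m≢i rewrite ≢⇒≡ᵇ-false m≢i = refl
posIn-snoc {i} (x ∷ r) m≢i with x ≡ᵇ i
... | true  = refl
... | false = cong (Maybe.map suc) (posIn-snoc r m≢i)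

posIn-∉ : ∀ {i} r → All (_≢ i) r → posIn i r ≡ nothing
posIn-∉ []      _                = refl
posIn-∉ (x ∷ r) (x≢i ∷ i∉r) rewrite ≢⇒≡ᵇ-false x≢i | posIn-∉ r i∉r = refl

posIn-last : ∀ {m} r → All (_≢ m) r → posIn m (r ++ [ m ]) ≡ just (suc (length r))
posIn-last {m} []      _               rewrite ≡ᵇ-refl m = refl
posIn-last     (x ∷ r) (x≢m ∷ m∉r) rewrite ≢⇒≡ᵇ-false x≢m | posIn-last r m∉r = refl

colOf-++-∉ : ∀ {i} T U → All (All (_≢ i)) T → colOf i (T ++ U) ≡ colOf i U
colOf-++-∉         []      U _                = refl
colOf-++-∉ {i} (r ∷ T) U (i∉r ∷ i∉T) with posIn i r | posIn-∉ r i∉r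
... | nothing | refl = colOf-++-∉ T U i∉T

colOf-++-0 : ∀ {i} T U → colOf i U ≡ 0 → colOf i (T ++ U) ≡ colOf i T
colOf-++-0     []      U i∉U = i∉U
colOf-++-0 {i} (r ∷ T) U i∉U with posIn i r
... | just c  = refl
... | nothing = colOf-++-0 T U i∉U

colOf-row-cong : ∀ {i} T {r r′} U → posIn i r′ ≡ posIn i r → colOf i (T ++ r′ ∷ U) ≡ colOf i (T ++ r ∷ U)
colOf-row-cong {i} [] {r} {r′} U same with posIn i r′ | posIn i r | same
... | just c  | _ | refl = refl
... | nothing | _ | refl = refl
colOf-row-cong {i} (s ∷ T) U same with posIn i s
... | just c  = refl
... | nothing = colOf-row-cong T U same

sigma-cong : ∀ i x T → colOf i x ≡ colOf i T →
  (∀ k → colSize (suc k) (restrict i x) ≡ colSize (suc k) (restrict i T)) → sigma i x ≡ sigma i T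
sigma-cong i x T same-col same-size with colOf i x | colOf i T | same-col
... | zero          | _ | refl = refl
... | suc zero      | _ | refl = cong (λ c → i ∸ c + 1) (same-size 0)
... | suc (suc k)   | _ | refl = cong₂ (λ a b → a ∸ b + 1) (same-size k) (same-size (suc k))

sigma-at-first-column : ∀ i T → colOf i T ≡ 1 → sigma i T ≡ i ∸ colSize 1 (restrict i T) + 1
sigma-at-first-column i T col≡1 with colOf i T | col≡1
... | _ | refl = refl

sigma-at-column : ∀ i T k → colOf i T ≡ suc (suc k) →
  sigma i T ≡ colSize (suc k) (restrict i T) ∸ colSize (suc (suc k)) (restrict i T) + 1
sigma-at-column i T k col≡ with colOf i T | col≡
... | _ | refl = refl

colSize-++ : ∀ k T U → colSize k (T ++ U) ≡ colSize k T + colSize k U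
colSize-++ k T U = trans (cong length (filter-++ (λ r → k ≤? length r) T U)) (length-++ (filter (λ r → k ≤? length r) T))

rowsOfLength-++ : ∀ L T U → rowsOfLength L (T ++ U) ≡ rowsOfLength L T + rowsOfLength L U
rowsOfLength-++ L T U = trans (cong length (filter-++ (λ r → length r ≟ L) T U)) (length-++ (filter (λ r → length r ≟ L) T))

colSize-split : ∀ L T → colSize L T ≡ rowsOfLength L T + colSize (suc L) T
colSize-split L []      = refl
colSize-split L (r ∷ T) with <-cmp (length r) L
... | tri< r<L r≢L _
  rewrite filter-reject (λ s → length s ≟ L) {x = r} {xs = T} r≢L
        | filter-reject (λ s → L ≤? length s) {x = r} {xs = T} (<⇒≱ r<L)
        | filter-reject (λ s → suc L ≤? length s) {x = r} {xs = T} (<⇒≱ (m<n⇒m<1+n r<L))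
  = colSize-split L T
... | tri≈ _ refl _
  rewrite filter-accept (λ s → length s ≟ L) {x = r} {xs = T} refl
        | filter-accept (λ s → L ≤? length s) {x = r} {xs = T} ≤-refl
        | filter-reject (λ s → suc L ≤? length s) {x = r} {xs = T} (<-irrefl refl)
  = cong suc (colSize-split L T)
... | tri> _ r≢L L<r
  rewrite filter-reject (λ s → length s ≟ L) {x = r} {xs = T} r≢L
        | filter-accept (λ s → L ≤? length s) {x = r} {xs = T} (<⇒≤ L<r)
        | filter-accept (λ s → suc L ≤? length s) {x = r} {xs = T} L<r
  = trans (cong suc (colSize-split L T)) (sym (+-suc _ _))

restrict-≤ : ∀ {m} T → All (All (_≤ m)) T → restrict m T ≡ T
restrict-≤     []      _                = refl
restrict-≤ {m} (r ∷ T) (r≤m ∷ T≤m) = cong₂ _∷_ (filter-all (_≤? m) r≤m) (restrict-≤ T T≤m)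

restrict-append : ∀ {i m} T r U → i < m → restrict i (T ++ (r ++ [ m ]) ∷ U) ≡ restrict i (T ++ r ∷ U)
restrict-append {i} {m} T r U i<m = begin
  restrict i (T ++ (r ++ [ m ]) ∷ U)                     ≡⟨ map-++ _ T _ ⟩
  restrict i T ++ filter (_≤? i) (r ++ [ m ]) ∷ restrict i U
    ≡⟨ cong (λ s → restrict i T ++ s ∷ restrict i U) row ⟩
  restrict i T ++ filter (_≤? i) r ∷ restrict i U       ≡⟨ map-++ _ T _ ⟨
  restrict i (T ++ r ∷ U)                                ∎
  where
  open ≡-Reasoning
  row : filter (_≤? i) (r ++ [ m ]) ≡ filter (_≤? i) r
  row = trans (filter-++ (_≤? i) r [ m ])
              (trans (cong (filter (_≤? i) r ++_) (filter-reject (_≤? i) (<⇒≱ i<m))) (++-identityʳ _))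

colSize-restrict-newRow : ∀ {i m} k T → i < m → colSize (suc k) (restrict i (T ++ [ [ m ] ])) ≡ colSize (suc k) (restrict i T)
colSize-restrict-newRow {i} {m} k T i<m = begin
  colSize (suc k) (restrict i (T ++ [ [ m ] ]))                    ≡⟨ cong (colSize (suc k)) (map-++ _ T _) ⟩
  colSize (suc k) (restrict i T ++ [ filter (_≤? i) [ m ] ])       ≡⟨ colSize-++ (suc k) (restrict i T) _ ⟩
  colSize (suc k) (restrict i T) + colSize (suc k) [ filter (_≤? i) [ m ] ]
    ≡⟨ cong (λ s → colSize (suc k) (restrict i T) + colSize (suc k) [ s ]) (filter-reject (_≤? i) {xs = []} (<⇒≱ i<m)) ⟩
  colSize (suc k) (restrict i T) + 0                               ≡⟨ +-identityʳ _ ⟩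
  colSize (suc k) (restrict i T)                                   ∎
  where open ≡-Reasoning

colOf-first-row : ∀ {i c} r T → posIn i r ≡ just c → colOf i (r ∷ T) ≡ c
colOf-first-row {i} r T found with posIn i r | found
... | just _ | refl = refl

colSize-1 : ∀ T → All (_≢ []) T → colSize 1 T ≡ length T
colSize-1 T T≢[] = cong length (filter-all (λ r → 1 ≤? length r) (All.map (λ {r} → nonempty⇒1≤length r) T≢[]))

module _ {n : ℕ} where

  private
    m : ℕ
    m = suc n

  sigmas-lower : ∀ x T → (∀ {i} → i ≤ n → sigma i x ≡ sigma i T) → sigmas n x ≡ sigmas n T
  sigmas-lower x T same = product-map-congᴬ _ _ (All.tabulate (λ i∈ → proj₂ (∈-oneTo⁻ i∈))) same

  sigma-append-lower : ∀ {i} A r B → i ≤ n → sigma i (A ++ (r ++ [ m ]) ∷ B) ≡ sigma i (A ++ r ∷ B)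
  sigma-append-lower {i} A r B i≤n =
    sigma-cong i (A ++ (r ++ [ m ]) ∷ B) (A ++ r ∷ B) (colOf-row-cong A B (posIn-snoc r (<⇒≢ (s≤s i≤n) ∘ sym)))
                     (λ k → cong (colSize (suc k)) (restrict-append A r B (s≤s i≤n)))

  sigma-newRow-lower : ∀ {i} T → i ≤ n → sigma i (T ++ [ [ m ] ]) ≡ sigma i T
  sigma-newRow-lower {i} T i≤n =
    sigma-cong i (T ++ [ [ m ] ]) T (colOf-++-0 T _ not-in-new-row) (λ k → colSize-restrict-newRow k T (s≤s i≤n))
    where
    not-in-new-row : colOf i [ [ m ] ] ≡ 0
    not-in-new-row rewrite ≢⇒≡ᵇ-false {m} {i} (<⇒≢ (s≤s i≤n) ∘ sym) = refl

  append-≤ : ∀ A r B → All (All (_≤ n)) (A ++ r ∷ B) → All (All (_≤ m)) (A ++ (r ++ [ m ]) ∷ B)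
  append-≤ A r B T≤n = ++⁺ (++⁻ˡ A T≤m) (++⁺ (All.head rB≤m) (≤-refl ∷ []) ∷ All.tail rB≤m)
    where
    T≤m : All (All (_≤ m)) (A ++ r ∷ B)
    T≤m = All.map (All.map m≤n⇒m≤1+n) T≤n
    rB≤m : All (All (_≤ m)) (r ∷ B)
    rB≤m = ++⁻ʳ A T≤m

  sigma-append-top : ∀ A r B → All (All (_≤ n)) (A ++ r ∷ B) → 1 ≤ length r →
    sigma m (A ++ (r ++ [ m ]) ∷ B) ≡ rowsOfLength (length r) (A ++ r ∷ B)
  sigma-append-top A r@(_ ∷ r′) B T≤n _ = begin
    sigma m x
      ≡⟨ sigma-at-column m x (length r′) (trans (colOf-++-∉ A _ m∉A) (colOf-first-row (r ++ [ m ]) B (posIn-last r m∉r))) ⟩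
    colSize L (restrict m x) ∸ colSize (suc L) (restrict m x) + 1
      ≡⟨ cong (λ y → colSize L y ∸ colSize (suc L) y + 1) (restrict-≤ x x≤m) ⟩
    colSize L x ∸ colSize (suc L) x + 1
      ≡⟨ cong (λ c → c ∸ colSize (suc L) x + 1) (colSize-split L x) ⟩
    rowsOfLength L x + colSize (suc L) x ∸ colSize (suc L) x + 1
      ≡⟨ cong (_+ 1) (m+n∸n≡m (rowsOfLength L x) (colSize (suc L) x)) ⟩
    rowsOfLength L x + 1
      ≡⟨ cong (_+ 1) (rowsOfLength-++ L A _) ⟩
    rowsOfLength L A + rowsOfLength L ((r ++ [ m ]) ∷ B) + 1
      ≡⟨ cong (λ c → rowsOfLength L A + c + 1) (rowsOfLength-cons L (r ++ [ m ]) B) ⟩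
    rowsOfLength L A + (ind L (length (r ++ [ m ])) + rowsOfLength L B) + 1
      ≡⟨ cong (λ l → rowsOfLength L A + (ind L l + rowsOfLength L B) + 1) (length-snoc r m) ⟩
    rowsOfLength L A + (ind L (suc L) + rowsOfLength L B) + 1
      ≡⟨ cong (λ c → rowsOfLength L A + (c + rowsOfLength L B) + 1) (if-≡ᵇ-≢ {m = suc L} {L} 1+n≢n) ⟩
    rowsOfLength L A + rowsOfLength L B + 1
      ≡⟨ trans (+-assoc (rowsOfLength L A) _ 1) (cong (rowsOfLength L A +_) (+-comm (rowsOfLength L B) 1)) ⟩
    rowsOfLength L A + (1 + rowsOfLength L B)
      ≡⟨ cong (λ c → rowsOfLength L A + (c + rowsOfLength L B)) (if-≡ᵇ-refl L) ⟨
    rowsOfLength L A + (ind L L + rowsOfLength L B)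
      ≡⟨ cong (rowsOfLength L A +_) (rowsOfLength-cons L r B) ⟨
    rowsOfLength L A + rowsOfLength L (r ∷ B)
      ≡⟨ rowsOfLength-++ L A (r ∷ B) ⟨
    rowsOfLength L (A ++ r ∷ B) ∎
    where
    open ≡-Reasoning
    x : Tableau
    x = A ++ (r ++ [ m ]) ∷ B
    L : ℕ
    L = length r
    x≤m : All (All (_≤ m)) x
    x≤m = append-≤ A r B T≤n
    m∉A : All (All (_≢ m)) A
    m∉A = All.map (All.map (<⇒≢ ∘ s≤s)) (++⁻ˡ A T≤n)
    m∉r : All (_≢ m) r
    m∉r = All.map (<⇒≢ ∘ s≤s) (All.head (++⁻ʳ A T≤n))

  newRow-≤ : ∀ T → All (All (_≤ n)) T → All (All (_≤ m)) (T ++ [ [ m ] ])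
  newRow-≤ T T≤n = ++⁺ (All.map (All.map m≤n⇒m≤1+n) T≤n) ((≤-refl ∷ []) ∷ [])

  sigma-newRow-top : ∀ T → All (_≢ []) T → All (All (_≤ n)) T → length T ≤ n →
    sigma m (T ++ [ [ m ] ]) ≡ n + 1 ∸ length T
  sigma-newRow-top T T≢[] T≤n ℓ≤n = begin
    sigma m x                        ≡⟨ sigma-at-first-column m x (trans (colOf-++-∉ T _ m∉T) new-row) ⟩
    m ∸ colSize 1 (restrict m x) + 1 ≡⟨ cong (λ y → m ∸ colSize 1 y + 1) (restrict-≤ x x≤m) ⟩
    m ∸ colSize 1 x + 1              ≡⟨ cong (λ c → m ∸ c + 1) (trans (colSize-++ 1 T _) (cong (_+ 1) (colSize-1 T T≢[]))) ⟩
    suc n ∸ (length T + 1) + 1       ≡⟨ cong (λ c → suc n ∸ c + 1) (+-comm (length T) 1) ⟩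
    n ∸ length T + 1                 ≡⟨ +-∸-comm 1 ℓ≤n ⟨
    n + 1 ∸ length T                 ∎
    where
    open ≡-Reasoning
    x : Tableau
    x = T ++ [ [ m ] ]
    x≤m : All (All (_≤ m)) x
    x≤m = newRow-≤ T T≤n
    m∉T : All (All (_≢ m)) T
    m∉T = All.map (All.map (<⇒≢ ∘ s≤s)) T≤n
    new-row : colOf m [ [ m ] ] ≡ 1
    new-row rewrite ≡ᵇ-refl m = refl

  weight-append : ∀ A r B → IsSYT n (A ++ r ∷ B) →
    weight m (A ++ (r ++ [ m ]) ∷ B) ≡ weight n (A ++ r ∷ B) * (suc (length r) * rowsOfLength (length r) (A ++ r ∷ B))
  weight-append A r B syt = begin
    weight m x
      ≡⟨ weight≡sigmas*factorials m x x-rowLengths ⟩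
    sigmas m x * factorials x
      ≡⟨ cong (_* factorials x) (product-map-oneTo-suc (λ i → sigma i x) n) ⟩
    sigmas n x * sigma m x * factorials x
      ≡⟨ cong₂ (λ s σ → s * σ * factorials x) (sigmas-lower x T (sigma-append-lower A r B))
               (sigma-append-top A r B T≤n (proj₁ r-length)) ⟩
    sigmas n T * R * factorials x
      ≡⟨ cong (sigmas n T * R *_) (trans (factorials-++ A _) (cong (λ l → factorials A * (l ! * factorials B)) (length-snoc r m))) ⟩
    sigmas n T * R * (factorials A * (suc L * L ! * factorials B))
      ≡⟨ solve 6 (λ s R a l f b → s :* R :* (a :* ((con 1 :+ l) :* f :* b)) := s :* (a :* (f :* b)) :* ((con 1 :+ l) :* R))
           refl (sigmas n T) R (factorials A) L (L !) (factorials B) ⟩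
    sigmas n T * (factorials A * (L ! * factorials B)) * (suc L * R)
      ≡⟨ cong (λ f → sigmas n T * f * (suc L * R)) (factorials-++ A (r ∷ B)) ⟨
    sigmas n T * factorials T * (suc L * R)
      ≡⟨ cong (_* (suc L * R)) (weight≡sigmas*factorials n T (IsSYT-rowLengths syt)) ⟨
    weight n T * (suc L * R) ∎
    where
    open ≡-Reasoning
    T : Tableau
    T = A ++ r ∷ B
    x : Tableau
    x = A ++ (r ++ [ m ]) ∷ B
    L : ℕ
    L = length r
    R : ℕ
    R = rowsOfLength L T
    T≤n : All (All (_≤ n)) T
    T≤n = All.map (All.map proj₂) (IsSYT-entries syt)
    widen : ∀ {U} → All (λ s → 1 ≤ length s × length s ≤ n) U → All (λ s → 1 ≤ length s × length s ≤ m) U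
    widen = All.map (λ (1≤s , s≤n) → 1≤s , m≤n⇒m≤1+n s≤n)
    r-length : 1 ≤ length r × length r ≤ n
    r-length = All.head (++⁻ʳ A (IsSYT-rowLengths syt))
    x-rowLengths : All (λ s → 1 ≤ length s × length s ≤ m) x
    x-rowLengths = ++⁺ (widen (++⁻ˡ A (IsSYT-rowLengths syt)))
      ((subst (λ l → 1 ≤ l × l ≤ m) (sym (length-snoc r m)) (s≤s z≤n , s≤s (proj₂ r-length)))
       ∷ widen (All.tail (++⁻ʳ A (IsSYT-rowLengths syt))))

  weight-newRow : ∀ T → IsSYT n T → weight m (T ++ [ [ m ] ]) ≡ weight n T * (n + 1 ∸ length T)
  weight-newRow T syt = begin
    weight m x                               ≡⟨ weight≡sigmas*factorials m x x-rowLengths ⟩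
    sigmas m x * factorials x                ≡⟨ cong (_* factorials x) (product-map-oneTo-suc (λ i → sigma i x) n) ⟩
    sigmas n x * sigma m x * factorials x
      ≡⟨ cong₂ (λ s σ → s * σ * factorials x) (sigmas-lower x T (sigma-newRow-lower T))
               (sigma-newRow-top T (IsSYT.nonempty syt) (All.map (All.map proj₂) (IsSYT-entries syt)) (IsSYT-numRows syt)) ⟩
    sigmas n T * j * factorials x            ≡⟨ cong (sigmas n T * j *_) (factorials-++ T _) ⟩
    sigmas n T * j * (factorials T * 1)
      ≡⟨ solve 3 (λ s j f → s :* j :* (f :* con 1) := s :* f :* j) refl (sigmas n T) j (factorials T) ⟩
    sigmas n T * factorials T * j            ≡⟨ cong (_* j) (weight≡sigmas*factorials n T (IsSYT-rowLengths syt)) ⟨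
    weight n T * j                           ∎
    where
    open ≡-Reasoning
    x : Tableau
    x = T ++ [ [ m ] ]
    j : ℕ
    j = n + 1 ∸ length T
    x-rowLengths : All (λ s → 1 ≤ length s × length s ≤ m) x
    x-rowLengths = ++⁺ (All.map (λ (1≤s , s≤n) → 1≤s , m≤n⇒m≤1+n s≤n) (IsSYT-rowLengths syt)) ((s≤s z≤n , s≤s z≤n) ∷ [])

-- The recurrence for tableaux

-- Σ (|r| + 1) w_{|r|}(T) over the rows r of B that are shorter than the row below them
-- (the row below the first row of B having length b): the rows that can receive n + 1.
cornerWeight : Tableau → ℕ → Tableau → ℕ
cornerWeight T b []      = 0
cornerWeight T b (r ∷ B) =
  (if length r <ᵇ b then suc (length r) * rowsOfLength (length r) T else 0) + cornerWeight T (length r) B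

Weakly-decreasing : Tableau → Set
Weakly-decreasing = Linked (λ lo up → length up ≤ length lo)

Weakly-decreasing⇒≤first : ∀ {r B} → Weakly-decreasing (r ∷ B) → All (λ s → length s ≤ length r) B
Weakly-decreasing⇒≤first [-]            = []
Weakly-decreasing⇒≤first {r} (s≤r ∷ B-dec) = Linked⇒All (λ p q → ≤-trans q p) {v = r} s≤r B-dec

ColOK⇒Weakly-decreasing : ∀ {T} → Linked ColOK T → Weakly-decreasing T
ColOK⇒Weakly-decreasing []                       = []
ColOK⇒Weakly-decreasing [-]                      = [-]
ColOK⇒Weakly-decreasing {lo ∷ up ∷ _} (ok ∷ cols) = ColOK⇒length≤ lo up ok ∷ ColOK⇒Weakly-decreasing cols

rowsOfLength-shorter : ∀ L B → All (λ s → length s < L) B → rowsOfLength L B ≡ 0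
rowsOfLength-shorter L []      []            = refl
rowsOfLength-shorter L (s ∷ B) (s<L ∷ B<L) =
  trans (rowsOfLength-cons L s B) (cong₂ _+_ (if-≡ᵇ-≢ (<⇒≢ s<L)) (rowsOfLength-shorter L B B<L))

cornerWeight-cons-longer : ∀ r U b B → b ≤ length r → All (λ s → length s ≤ length r) B →
  cornerWeight (r ∷ U) b B ≡ cornerWeight U b B
cornerWeight-cons-longer r U b []      _   _             = refl
cornerWeight-cons-longer r U b (s ∷ B) b≤r (s≤r ∷ B≤r) with length s <ᵇ b in s<b
... | false = cornerWeight-cons-longer r U (length s) B s≤r B≤r
... | true  = cong₂ _+_
  (cong (suc (length s) *_) (trans (rowsOfLength-cons (length s) r U)
    (cong (_+ rowsOfLength (length s) U) (if-≡ᵇ-≢ (λ r≡s → <-irrefl (sym r≡s) (<-≤-trans (<ᵇ-true⇒< s<b) b≤r))))))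
  (cornerWeight-cons-longer r U (length s) B s≤r B≤r)

cornerWeight-raise : ∀ U L → Weakly-decreasing U → All (λ s → length s ≤ L) U →
  cornerWeight U L U + suc L * rowsOfLength L U ≡ cornerWeight U (suc L) U
cornerWeight-raise []      L _     _             = *-zeroʳ (suc L)
cornerWeight-raise (s ∷ U) L U-dec (s≤L ∷ U≤L) with length s ≟ L
... | yes refl rewrite ≥⇒<ᵇ-false (≤-refl {length s}) | <⇒<ᵇ-true (n<1+n (length s)) =
  +-comm (cornerWeight (s ∷ U) (length s) U) _
... | no s≢L rewrite <⇒<ᵇ-true (≤∧≢⇒< s≤L s≢L) | <⇒<ᵇ-true (m≤n⇒m≤1+n (≤∧≢⇒< s≤L s≢L))
                   | rowsOfLength-shorter L (s ∷ U) (≤∧≢⇒< s≤L s≢L ∷ All.map (λ t≤s → ≤-<-trans t≤s (≤∧≢⇒< s≤L s≢L))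
                                                                           (Weakly-decreasing⇒≤first U-dec))
                   | *-zeroʳ (suc L) = +-identityʳ _

-- Each row length L occurring in T is counted once, by its highest row, with weight
-- (L + 1) w_L(T): altogether every row r contributes |r| + 1.
cornerWeight-self : ∀ T b → Weakly-decreasing T → All (λ s → length s < b) T →
  cornerWeight T b T ≡ sum (map (λ r → suc (length r)) T)
cornerWeight-self []      b _     _           = refl
cornerWeight-self (r ∷ U) b T-dec (r<b ∷ _) rewrite <⇒<ᵇ-true r<b = begin
  suc L * rowsOfLength L (r ∷ U) + cornerWeight (r ∷ U) L U
    ≡⟨ cong₂ _+_ (cong (suc L *_) (trans (rowsOfLength-cons L r U) (cong (_+ rowsOfLength L U) (if-≡ᵇ-refl L))))
                 (cornerWeight-cons-longer r U L U ≤-refl U≤r) ⟩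
  suc L * suc (rowsOfLength L U) + cornerWeight U L U
    ≡⟨ solve 3 (λ l w c → (con 1 :+ l) :* (con 1 :+ w) :+ c := (con 1 :+ l) :+ (c :+ (con 1 :+ l) :* w))
         refl L (rowsOfLength L U) (cornerWeight U L U) ⟩
  suc L + (cornerWeight U L U + suc L * rowsOfLength L U)
    ≡⟨ cong (suc L +_) (cornerWeight-raise U L (Linked.tail T-dec) U≤r) ⟩
  suc L + cornerWeight U (suc L) U
    ≡⟨ cong (suc L +_) (cornerWeight-self U (suc L) (Linked.tail T-dec) (All.map s≤s U≤r)) ⟩
  suc L + sum (map (λ r → suc (length r)) U) ∎
  where
  open ≡-Reasoning
  L : ℕ
  L = length r
  U≤r : All (λ s → length s ≤ L) U
  U≤r = Weakly-decreasing⇒≤first T-dec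

sum-suc-length : ∀ (T : Tableau) → sum (map (λ r → suc (length r)) T) ≡ length (concat T) + length T
sum-suc-length []      = refl
sum-suc-length (r ∷ T) rewrite sum-suc-length T | length-++ r {concat T} =
  solve 3 (λ a b c → con 1 :+ a :+ (b :+ c) := a :+ b :+ (con 1 :+ c)) refl (length r) (length (concat T)) (length T)

cornerWeight-IsSYT : ∀ {n T} → IsSYT n T → cornerWeight T (suc n) T ≡ n + length T
cornerWeight-IsSYT {n} {T} syt = begin
  cornerWeight T (suc n) T
    ≡⟨ cornerWeight-self T (suc n) (ColOK⇒Weakly-decreasing (IsSYT.colsInc syt))
                         (All.map (λ (_ , r≤n) → s≤s r≤n) (IsSYT-rowLengths syt)) ⟩
  sum (map (λ r → suc (length r)) T) ≡⟨ sum-suc-length T ⟩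
  length (concat T) + length T       ≡⟨ cong (_+ length T) (IsSYT-size syt) ⟩
  n + length T                       ∎
  where open ≡-Reasoning

module _ {n : ℕ} (k : ℕ) where

  private
    m : ℕ
    m = suc n

  term : Tableau → ℕ
  term x = if (m + 1 ∸ numRows x) ≡ᵇ k then weight m x else 0

  term-newRow : ∀ T → IsSYT n T → term (T ++ [ [ m ] ]) ≡ weight n T * ((n + 1 ∸ length T) * ind k (n + 1 ∸ length T))
  term-newRow T syt = begin
    term (T ++ [ [ m ] ])
      ≡⟨ cong₂ (λ s w → if s ≡ᵇ k then w else 0) stat (weight-newRow T syt) ⟩
    (if j ≡ᵇ k then weight n T * j else 0) ≡⟨ if-then-else-0 (j ≡ᵇ k) _ ⟩
    weight n T * j * ind k j               ≡⟨ *-assoc (weight n T) j _ ⟩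
    weight n T * (j * ind k j)             ∎
    where
    open ≡-Reasoning
    j : ℕ
    j = n + 1 ∸ length T
    stat : m + 1 ∸ length (T ++ [ [ m ] ]) ≡ j
    stat = trans (cong (m + 1 ∸_) (length-++ T)) (cong (λ l → suc n + 1 ∸ l) (+-comm (length T) 1))

  term-append : ∀ A r B → IsSYT n (A ++ r ∷ B) → term (A ++ (r ++ [ m ]) ∷ B) ≡
    weight n (A ++ r ∷ B) * (suc (length r) * rowsOfLength (length r) (A ++ r ∷ B)) * ind k (suc (n + 1 ∸ length (A ++ r ∷ B)))
  term-append A r B syt = trans (cong₂ (λ s w → if s ≡ᵇ k then w else 0) stat (weight-append A r B syt))
    (if-then-else-0 (suc (n + 1 ∸ length (A ++ r ∷ B)) ≡ᵇ k) _)
    where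
    stat : m + 1 ∸ length (A ++ (r ++ [ m ]) ∷ B) ≡ suc (n + 1 ∸ length (A ++ r ∷ B))
    stat = trans (cong (m + 1 ∸_) (trans (length-++ A) (sym (length-++ A))))
                 (+-∸-assoc 1 (≤-trans (IsSYT-numRows syt) (m≤m+n n 1)))

  sum-term-skip : ∀ A r L → sum (map (λ x → term (A ++ x)) (map (r ∷_) L)) ≡ sum (map (λ x → term ((A ++ [ r ]) ++ x)) L)
  sum-term-skip A r L = cong sum (trans (sym (map-∘ L)) (map-cong (λ x → cong term (sym (++-assoc A [ r ] x))) L))

  sum-term-addMax : ∀ {T} → IsSYT n T → ∀ A b B → A ++ B ≡ T →
    let j = n + 1 ∸ length T in
    sum (map (λ x → term (A ++ x)) (addMax m b B)) ≡
      weight n T * (j * ind k j) + weight n T * ind k (suc j) * cornerWeight T b B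
  sum-term-addMax syt A b [] A≡T with trans (sym (++-identityʳ A)) A≡T
  ... | refl = begin
    term (A ++ [ [ m ] ]) + 0      ≡⟨ +-identityʳ _ ⟩
    term (A ++ [ [ m ] ])          ≡⟨ term-newRow A syt ⟩
    weight n A * (j * ind k j)     ≡⟨ +-identityʳ _ ⟨
    weight n A * (j * ind k j) + 0 ≡⟨ cong (weight n A * (j * ind k j) +_) (*-zeroʳ (weight n A * ind k (suc j))) ⟨
    weight n A * (j * ind k j) + weight n A * ind k (suc j) * 0 ∎
    where
    open ≡-Reasoning
    j : ℕ
    j = n + 1 ∸ length A
  sum-term-addMax {T} syt A b (r ∷ B) refl
    with length r <ᵇ b
       | trans (sum-term-skip A r (addMax m (length r) B))
               (sum-term-addMax syt (A ++ [ r ]) (length r) B (++-assoc A [ r ] B))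
  ... | false | rest = rest
  ... | true  | rest = begin
    term (A ++ (r ++ [ m ]) ∷ B) + sum (map (λ x → term (A ++ x)) (map (r ∷_) (addMax m (length r) B)))
      ≡⟨ cong₂ _+_ (term-append A r B syt) rest ⟩
    W * c * ind k (suc j) + (W * (j * ind k j) + W * ind k (suc j) * cornerWeight T (length r) B)
      ≡⟨ solve 5 (λ W c i x s → W :* c :* i :+ (W :* x :+ W :* i :* s) := W :* x :+ W :* i :* (c :+ s))
           refl W c (ind k (suc j)) (j * ind k j) (cornerWeight T (length r) B) ⟩
    W * (j * ind k j) + W * ind k (suc j) * (c + cornerWeight T (length r) B) ∎
    where
    open ≡-Reasoning
    W : ℕ
    W = weight n T
    j : ℕ
    j = n + 1 ∸ length T
    c : ℕ
    c = suc (length r) * rowsOfLength (length r) T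

2n+1∸[n+1∸l]≡n+l : ∀ n l → l ≤ n → suc (2 * n) ∸ (n + 1 ∸ l) ≡ n + l
2n+1∸[n+1∸l]≡n+l n l l≤n = begin
  suc (2 * n) ∸ d   ≡⟨ cong (_∸ d) total ⟨
  n + l + d ∸ d     ≡⟨ m+n∸n≡m (n + l) d ⟩
  n + l             ∎
  where
  open ≡-Reasoning
  d : ℕ
  d = n + 1 ∸ l
  total : n + l + d ≡ suc (2 * n)
  total = begin
    n + l + d     ≡⟨ +-assoc n l d ⟩
    n + (l + d)   ≡⟨ cong (n +_) (m+[n∸m]≡n (≤-trans l≤n (m≤m+n n 1))) ⟩
    n + (n + 1)   ≡⟨ solve 1 (λ n → n :+ (n :+ con 1) := con 1 :+ con 2 :* n) refl n ⟩
    suc (2 * n)   ∎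

RCoeff-syts-suc : ∀ n k → RCoeff (suc n) (syts (suc n)) k ≡ step (suc (2 * n)) (RCoeff n (syts n)) k
RCoeff-syts-suc n k = begin
  RCoeff (suc n) (syts (suc n)) k
    ≡⟨ sum-map-concatMap (term k) (addMax (suc n) (suc n)) (syts n) ⟩
  sum (map (λ T → sum (map (term k) (addMax (suc n) (suc n) T))) (syts n))
    ≡⟨ sum-map-congᴬ _ _ (syts-IsSYT n) children ⟩
  sum (map (λ T → weight n T * spread (suc (2 * n)) (ind k) (n + 1 ∸ numRows T)) (syts n))
    ≡⟨ sum-scaled-spread≡step-Coef (λ T → n + 1 ∸ numRows T) (weight n) (suc (2 * n)) k (syts n) ⟩
  step (suc (2 * n)) (RCoeff n (syts n)) k ∎
  where
  open ≡-Reasoning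
  children : ∀ {T} → IsSYT n T →
    sum (map (term k) (addMax (suc n) (suc n) T)) ≡ weight n T * spread (suc (2 * n)) (ind k) (n + 1 ∸ numRows T)
  children {T} syt = begin
    sum (map (term k) (addMax (suc n) (suc n) T))
      ≡⟨ sum-term-addMax k syt [] (suc n) T refl ⟩
    W * (j * ind k j) + W * ind k (suc j) * cornerWeight T (suc n) T
      ≡⟨ cong (λ c → W * (j * ind k j) + W * ind k (suc j) * c)
              (trans (cornerWeight-IsSYT syt) (sym (2n+1∸[n+1∸l]≡n+l n (length T) (IsSYT-numRows syt)))) ⟩
    W * (j * ind k j) + W * ind k (suc j) * (suc (2 * n) ∸ j)
      ≡⟨ solve 4 (λ W x i c → W :* x :+ W :* i :* c := W :* (x :+ c :* i))
           refl W (j * ind k j) (ind k (suc j)) (suc (2 * n) ∸ j) ⟩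
    W * spread (suc (2 * n)) (ind k) j ∎
    where
    W : ℕ
    W = weight n T
    j : ℕ
    j = n + 1 ∸ length T

-- The two sides differ at n = 0 (1 against x), so the induction starts at n = 1.
CCoeff-stirlings≡RCoeff-syts : ∀ n → 1 ≤ n → ∀ k → CCoeff (stirlings n) k ≡ RCoeff n (syts n) k
CCoeff-stirlings≡RCoeff-syts 1             _ k = refl
CCoeff-stirlings≡RCoeff-syts (suc (suc n)) _ k = begin
  CCoeff (stirlings (suc (suc n))) k                 ≡⟨ CCoeff-stirlings-suc (suc n) k ⟩
  step (suc (2 * suc n)) (CCoeff (stirlings (suc n))) k
    ≡⟨ step-cong (suc (2 * suc n)) (CCoeff-stirlings≡RCoeff-syts (suc n) (s≤s z≤n)) k ⟩
  step (suc (2 * suc n)) (RCoeff (suc n) (syts (suc n))) k ≡⟨ RCoeff-syts-suc (suc n) k ⟨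
  RCoeff (suc (suc n)) (syts (suc (suc n))) k        ∎
  where open ≡-Reasoning

theorem4p8 : (n : ℕ) → 1 ≤ n →
    (LQ : List Word) → Unique LQ → (∀ w → (w ∈ LQ) ⇔ Stirling n w) →
    (LT : List Tableau) → Unique LT → (∀ T → (T ∈ LT) ⇔ IsSYT n T) →
    ∀ k → CCoeff LQ k ≡ RCoeff n LT k
theorem4p8 n 1≤n LQ LQ! LQ-spec LT LT! LT-spec k = begin
  CCoeff LQ k             ≡⟨ sum-map-sameMembers _ LQ! (stirlings-unique n) (λ w → ⇔-sym (∈-stirlings⇔ n w) ⇔-∘ LQ-spec w) ⟩
  CCoeff (stirlings n) k  ≡⟨ CCoeff-stirlings≡RCoeff-syts n 1≤n k ⟩
  RCoeff n (syts n) k     ≡⟨ sum-map-sameMembers _ (syts-unique n) LT! (λ T → ⇔-sym (LT-spec T) ⇔-∘ ∈-syts⇔ n T) ⟩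
  RCoeff n LT k           ∎
  where open ≡-Reasoning
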